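{- Let $\Gamma=K_{m_1}\times K_{m_2}\times\cdots\times K_{m_n}$ with $2\le m_1\le m_2\le\cdots\le m_n$ and $m_2\ge 3$. Then $\Gamma$ is $1/\mu$-RA for some $\mu$, where: (a) if $m_1=2$, then $\mu=\gcd\{m_i-2 : i=2,\dots,n\}$; (b) otherwise $\mu\le 2$, and $\mu=2$ if and only if all $m_i$ are even.
   Context: $K_m$ is the complete graph on $m$ vertices. The tensor product $\Gamma\times\Lambda$ has vertex set $V(\Gamma)\times V(\Lambda)$, with $(u_1,u_2)$ adjacent to $(v_1,v_2)$ iff $u_1$ is adjacent to $v_1$ and $u_2$ is adjacent to $v_2$. $N[v]$ is the closed neighbourhood of $v$; for a vertex set $S$, $\vec S$ is its $0/1$ indicator vector. The RA matrix $C_\Delta$ of a graph $\Delta$ on $N$ vertices has $N$ columns and rows $\vec{N[v]}$ for all vertices $v$ together with $\overrightarrow{N[u]\cap N[v]}$ for all pairs $u,v$. For $k\ge1$, $\Delta$ is $1/k$-RA if for every ordering of the columns of $C_\Delta$, the diagonal of the Hermite normal form of $C_\Delta$ is $(1,\dots,1,k)$ ($N-1$ ones); $1/1$-RA means the $\mathbb{Z}$-row span of $C_\Delta$ is $\mathbb{Z}^N$. -}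

module Defs where

open import Data.Nat using (ℕ; suc; _≤_; _∸_; _≡ᵇ_)
open import Data.Nat.GCD using (gcd)
open import Data.Integer using (ℤ; +_; _+_; _*_; 0ℤ; 1ℤ)
open import Data.Integer.Divisibility using () renaming (_∣_ to _∣ℤ_)
open import Data.Fin using (Fin; toℕ) renaming (_<_ to _<ᶠ_)
open import Data.Fin.Properties using () renaming (_≟_ to _≟ᶠ_)
open import Data.Vec using (Vec; []; _∷_; foldr; map)
open import Data.List using (List)
import Data.List as L
open import Data.Product using (Σ; ∃; _×_; _,_)
open import Data.Product.Properties using (≡-dec)
open import Data.Sum using (_⊎_; inj₁; inj₂)
open import Data.Bool using (if_then_else_)
open import Relation.Binary.PropositionalEquality using (_≡_; _≢_)
open import Relation.Binary.Definitions using (DecidableEquality)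
open import Relation.Nullary using (Dec; ¬?; ⌊_⌋)
open import Relation.Nullary.Decidable using (_×-dec_; _⊎-dec_)
open import Function.Bundles using (_⤖_; Bijection)

record Graph : Set₁ where
  field
    V    : Set
    _≟_  : DecidableEquality V
    Adj  : V → V → Set
    adj? : ∀ u v → Dec (Adj u v)

open Graph public

K : ℕ → Graph
K m = record { V = Fin m ; _≟_ = _≟ᶠ_ ; Adj = λ a b → a ≢ b ; adj? = λ a b → ¬? (a ≟ᶠ b) }

_⊗_ : Graph → Graph → Graph
Γ ⊗ Λ = record
  { V    = V Γ × V Λ
  ; _≟_  = ≡-dec (_≟_ Γ) (_≟_ Λ)
  ; Adj  = λ { (u₁ , u₂) (v₁ , v₂) → Adj Γ u₁ v₁ × Adj Λ u₂ v₂ }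
  ; adj? = λ { (u₁ , u₂) (v₁ , v₂) → adj? Γ u₁ v₁ ×-dec adj? Λ u₂ v₂ }
  }

prodK : ∀ {n} → Vec ℕ (suc n) → Graph
prodK (x ∷ [])     = K x
prodK (x ∷ y ∷ ys) = K x ⊗ prodK (y ∷ ys)

module _ (Γ : Graph) where
  inN? : (v w : V Γ) → Dec (w ≡ v ⊎ Adj Γ v w)
  inN? v w = (_≟_ Γ w v) ⊎-dec adj? Γ v w

  -- Rows of the RA matrix C_Γ, indexed by vertices v (row N[v]) and by
  -- pairs (u , v) (row N[u] ∩ N[v]); each row is a vector V Γ → ℤ.
  Row : Set
  Row = V Γ ⊎ (V Γ × V Γ)

  row : Row → V Γ → ℤ
  row (inj₁ v)       w = if ⌊ inN? v w ⌋ then 1ℤ else 0ℤ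
  row (inj₂ (u , v)) w = if ⌊ inN? u w ×-dec inN? v w ⌋ then 1ℤ else 0ℤ

  InRowSpan : (V Γ → ℤ) → Set
  InRowSpan x = Σ (List (ℤ × Row)) λ l →
    ∀ w → x w ≡ L.foldr (λ { (c , r) acc → c * row r w + acc }) 0ℤ l

  -- d is the HNF diagonal of C_Γ for the column ordering σ
  -- (column i of the reordered matrix is vertex σ i).  For the row-style
  -- HNF H = U·C (U unimodular, H upper triangular), the i-th diagonal entry
  -- is the nonnegative generator of the ideal of i-th coordinates of
  -- lattice vectors whose first i coordinates (0..i-1) vanish; we require
  -- the entries to be positive (full column rank).
  IsHNFDiagonal : ∀ {N} → Fin N ⤖ V Γ → (Fin N → ℕ) → Set
  IsHNFDiagonal {N} σ d = ∀ i →
      1 ≤ d i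
    × (Σ (V Γ → ℤ) λ x → InRowSpan x
         × (∀ j → j <ᶠ i → x (Bijection.to σ j) ≡ 0ℤ)
         × x (Bijection.to σ i) ≡ + d i)
    × (∀ x → InRowSpan x
         → (∀ j → j <ᶠ i → x (Bijection.to σ j) ≡ 0ℤ)
         → (+ d i) ∣ℤ x (Bijection.to σ i))

onesThen : (N k : ℕ) → Fin N → ℕ
onesThen N k i = if suc (toℕ i) ≡ᵇ N then k else 1

-- Γ is 1/k-RA: k ≥ 1 and for every ordering of the N = |V Γ| columns
-- (a bijection Fin N ⤖ V Γ) the HNF diagonal is (1, …, 1, k).
IsRA : ℕ → Graph → Set
IsRA k Γ = 1 ≤ k × (∀ N (σ : Fin N ⤖ V Γ) → IsHNFDiagonal Γ σ (onesThen N k))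

-- gcd of a vector of naturals (gcd of empty collection = 0)
gcdVec : ∀ {n} → Vec ℕ n → ℕ
gcdVec = foldr _ gcd 0

-- Fix signs ε : V → {±1}, a base vertex v₀ and the functional φ x = Σ_w ε_w x_w on ℤ^V.
-- If every δ_w − ε_w δ_{v₀} lies in the row lattice L, then so does δ_v − ε_v ε_w δ_w for all
-- v, w, these span ker φ, and L = {x : φ x ∈ φ(L)}; so for every column order the HNF diagonal
-- is (1, …, 1, μ) with φ(L) = μℤ, i.e. μ divides φ of every row and μ δ_{v₀} ∈ L.
-- In Γ = K_{m₁} × ⋯ × K_{m_n} the differences δ_v − δ_{v′} come from twins: if v, v′ ∉ N[u]
-- have the same neighbours outside N(u), then N[v] − N[v′] − N[u]∩N[v] + N[u]∩N[v′] = δ_v − δ_{v′},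
-- and factors of size ≥ 3 link all vertices in this way.  When m₁ = 2, ε is the sign of the K₂
-- coordinate (the two layers are joined along an edge, whose ends have no common neighbour);
-- otherwise ε = 1.  On rows, φ is expressed through the common-neighbour counts
-- C(u, v) = Π_i (m_i − 2 + [u_i = v_i]): all its values lie in dℤ once d divides every m_i − 2
-- (and 2 when ε = 1), and the rows N[u] ∩ N[v₀] force exactly these numbers into φ(L).
-- Hence μ = gcd{m_i − 2 : i ≥ 2} when m₁ = 2, and μ = gcd{2, m_i − 2} otherwise.

module Submission where

open import Data.Nat using (ℕ; suc; _≤_; _∸_)
import Data.Nat as ℕ
import Data.Nat.Properties as ℕP
import Data.Nat.Divisibility as ℕD
open import Data.Nat.Divisibility using (_∣_)
open import Data.Fin using (Fin; zero; suc) renaming (_≤_ to _≤ᶠ_)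
open import Data.Fin using (toℕ; fromℕ) renaming (_<_ to _<ᶠ_)
import Data.Fin.Properties as FinP
open import Data.Fin.Properties using () renaming (_≟_ to _≟ᶠ_)
open import Data.Vec using (Vec; lookup; tail; map)
open import Data.Vec using ([]; _∷_)
open import Data.Product using (∃; _×_)
open import Relation.Binary.PropositionalEquality using (_≡_; _≢_)
open import Function.Bundles using (_⇔_)
open import Defs

open import Data.Bool using (true; false; if_then_else_; T)
open import Data.Integer using (ℤ; +_; -_; _+_; _*_; _-_; 0ℤ; 1ℤ; -1ℤ)
import Data.Integer.Properties as ℤ
open import Data.Integer.Divisibility using () renaming (_∣_ to _∣ᵤ_)
open import Data.Integer.Divisibility.Signed using (divides; ∣⇒∣ᵤ; ∣ᵤ⇒∣; ∣m∣n⇒∣m+n; ∣n⇒∣m*n) renaming (_∣_ to _∣ℤ_)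
open import Data.Integer.Tactic.RingSolver using (solve-∀)
open import Data.List using (List; []; _∷_; _++_; allFin; tabulate; cartesianProduct)
import Data.List as List
open import Data.Nat.GCD using (gcd)
import Data.Nat.GCD as GCD
open import Data.Product using (Σ; _,_; proj₁; proj₂)
open import Data.Sum using (_⊎_; inj₁; inj₂; [_,_]′)
open import Function using (_∘_)
open import Relation.Binary.Bundles using (Setoid)
import Relation.Binary.Reasoning.Setoid as SetoidReasoning
open import Data.Vec.Relation.Unary.All using (All; []; _∷_)
import Data.Vec.Relation.Unary.All as All
import Data.Vec.Relation.Unary.All.Properties as All⁺
import Relation.Binary.Construct.Closure.Transitive as Plus
open Plus using (Plus; [_]; _∼⁺⟨_⟩_)
open import Function.Bundles using (mk⇔; Equivalence; _⤖_; Bijection)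
open import Relation.Binary.PropositionalEquality using (refl; sym; trans; cong; cong₂; subst; module ≡-Reasoning)
open import Relation.Nullary using (Dec; yes; no; ¬_; ⌊_⌋; contradiction)
open import Relation.Nullary.Decidable using (_×-dec_; _⊎-dec_; ¬?; decidable-stable)

private variable
  A B : Set

𝟙 : Dec A → ℤ
𝟙 a = if ⌊ a ⌋ then 1ℤ else 0ℤ

𝟙-yes : (a : Dec A) → A → 𝟙 a ≡ 1ℤ
𝟙-yes (yes _) _ = refl
𝟙-yes (no ¬a) a = contradiction a ¬a

𝟙-no : (a : Dec A) → ¬ A → 𝟙 a ≡ 0ℤ
𝟙-no (yes a) ¬a = contradiction a ¬a
𝟙-no (no _)  _  = refl

𝟙-cong : A ⇔ B → (a : Dec A) (b : Dec B) → 𝟙 a ≡ 𝟙 b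
𝟙-cong A⇔B a (yes b) = 𝟙-yes a (Equivalence.from A⇔B b)
𝟙-cong A⇔B a (no ¬b) = 𝟙-no a (¬b ∘ Equivalence.to A⇔B)

𝟙-× : (a : Dec A) (b : Dec B) → 𝟙 (a ×-dec b) ≡ 𝟙 a * 𝟙 b
𝟙-× (yes _) (yes _) = refl
𝟙-× (yes _) (no _)  = refl
𝟙-× (no _)  _       = refl

𝟙-⊎ : ¬ (A × B) → (a : Dec A) (b : Dec B) → 𝟙 (a ⊎-dec b) ≡ 𝟙 a + 𝟙 b
𝟙-⊎ disjoint (yes a) (yes b) = contradiction (a , b) disjoint
𝟙-⊎ disjoint (yes _) (no _)  = refl
𝟙-⊎ disjoint (no _)  (yes _) = refl
𝟙-⊎ disjoint (no _)  (no _)  = refl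

𝟙-¬ : (a : Dec A) → 𝟙 (¬? a) ≡ 1ℤ - 𝟙 a
𝟙-¬ (yes _) = refl
𝟙-¬ (no _)  = refl

𝟙-idem : (a : Dec A) → 𝟙 a * 𝟙 a ≡ 𝟙 a
𝟙-idem (yes _) = refl
𝟙-idem (no _)  = refl

∑ : List A → (A → ℤ) → ℤ
∑ []       f = 0ℤ
∑ (a ∷ as) f = f a + ∑ as f

syntax ∑ E (λ w → t) = ∑[ w ∈ E ] t

∑-cong : (as : List A) {f g : A → ℤ} → (∀ a → f a ≡ g a) → ∑ as f ≡ ∑ as g
∑-cong []       f≗g = refl
∑-cong (a ∷ as) f≗g = cong₂ _+_ (f≗g a) (∑-cong as f≗g)

∑-+ : (as : List A) (f g : A → ℤ) → ∑[ a ∈ as ] (f a + g a) ≡ ∑ as f + ∑ as g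
∑-+ []       f g = refl
∑-+ (a ∷ as) f g = trans (cong (_+_ (f a + g a)) (∑-+ as f g)) (swap (f a) (g a) (∑ as f) (∑ as g))
  where
  swap : ∀ p q r s → p + q + (r + s) ≡ p + r + (q + s)
  swap = solve-∀

∑-zero : (as : List A) → ∑[ a ∈ as ] 0ℤ ≡ 0ℤ
∑-zero []       = refl
∑-zero (a ∷ as) = trans (ℤ.+-identityˡ _) (∑-zero as)

∑-*ˡ : (as : List A) (c : ℤ) (f : A → ℤ) → ∑[ a ∈ as ] (c * f a) ≡ c * ∑ as f
∑-*ˡ []       c f = sym (ℤ.*-zeroʳ c)
∑-*ˡ (a ∷ as) c f = trans (cong (_+_ (c * f a)) (∑-*ˡ as c f)) (sym (ℤ.*-distribˡ-+ c (f a) (∑ as f)))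

∑-*ʳ : (as : List A) (c : ℤ) (f : A → ℤ) → ∑[ a ∈ as ] (f a * c) ≡ ∑ as f * c
∑-*ʳ as c f = trans (∑-cong as (λ a → ℤ.*-comm (f a) c)) (trans (∑-*ˡ as c f) (ℤ.*-comm c (∑ as f)))

∑-++ : (as bs : List A) (f : A → ℤ) → ∑ (as ++ bs) f ≡ ∑ as f + ∑ bs f
∑-++ []       bs f = sym (ℤ.+-identityˡ (∑ bs f))
∑-++ (a ∷ as) bs f = trans (cong (_+_ (f a)) (∑-++ as bs f)) (sym (ℤ.+-assoc (f a) (∑ as f) (∑ bs f)))

∑-map : (g : A → B) (as : List A) (f : B → ℤ) → ∑ (List.map g as) f ≡ ∑ as (f ∘ g)
∑-map g []       f = refl
∑-map g (a ∷ as) f = cong (_+_ (f (g a))) (∑-map g as f)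

∑-cartesianProduct : (as : List A) (bs : List B) (f : A × B → ℤ)
  → ∑ (cartesianProduct as bs) f ≡ ∑[ a ∈ as ] ∑[ b ∈ bs ] f (a , b)
∑-cartesianProduct []       bs f = refl
∑-cartesianProduct (a ∷ as) bs f = begin
  ∑ (List.map (a ,_) bs ++ cartesianProduct as bs) f            ≡⟨ ∑-++ (List.map (a ,_) bs) _ f ⟩
  ∑ (List.map (a ,_) bs) f + ∑ (cartesianProduct as bs) f       ≡⟨ cong₂ _+_ (∑-map (a ,_) bs f) (∑-cartesianProduct as bs f) ⟩
  ∑[ b ∈ bs ] f (a , b) + ∑[ a′ ∈ as ] ∑[ b ∈ bs ] f (a′ , b)   ∎
  where open ≡-Reasoning

∑-tabulate : ∀ {n} (g : Fin n → A) (f : A → ℤ) → ∑ (tabulate g) f ≡ ∑ (allFin n) (f ∘ g)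
∑-tabulate {n = 0}     g f = refl
∑-tabulate {n = suc n} g f =
  cong (_+_ (f (g zero))) (trans (∑-tabulate (g ∘ suc) f) (sym (∑-tabulate suc (f ∘ g))))

-- Ideals of ℤ

bézout-ℤ : ∀ a b x y d → d ℕ.+ y ℕ.* b ≡ x ℕ.* a → + x * + a + - + y * + b ≡ + d
bézout-ℤ a b x y d eq = begin
  + x * + a + - + y * + b          ≡⟨ cong (λ t → t + - + y * + b) (sym (ℤ.pos-* x a)) ⟩
  + (x ℕ.* a) + - + y * + b        ≡⟨ cong (λ t → + t + - + y * + b) (sym eq) ⟩
  + (d ℕ.+ y ℕ.* b) + - + y * + b  ≡⟨ cong (λ t → t + - + y * + b) (trans (ℤ.pos-+ d (y ℕ.* b)) (cong (_+_ (+ d)) (ℤ.pos-* y b))) ⟩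
  + d + + y * + b + - + y * + b    ≡⟨ cancel (+ d) (+ y) (+ b) ⟩
  + d                              ∎
  where
  open ≡-Reasoning
  cancel : ∀ d y b → d + y * b + - y * b ≡ d
  cancel = solve-∀

record IsIdeal (I : ℤ → Set) : Set where
  field
    0∈       : I 0ℤ
    +-closed : ∀ {a b} → I a → I b → I (a + b)
    *-closed : ∀ c {a} → I a → I (c * a)

  ∈-resp : ∀ {a b} → a ≡ b → I a → I b
  ∈-resp refl a∈ = a∈

  combination-closed : ∀ {a b} p q → I a → I b → I (p * a + q * b)
  combination-closed p q a∈ b∈ = +-closed (*-closed p a∈) (*-closed q b∈)

  infix 4 _≈_
  record _≈_ (a b : ℤ) : Set where
    eta-equality
    constructor by-difference
    field difference∈ : I (a - b)
  open _≈_ public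

  ≈-refl : ∀ {a} → a ≈ a
  ≈-refl {a} = by-difference (∈-resp (sym (ℤ.+-inverseʳ a)) 0∈)

  ≈-reflexive : ∀ {a b} → a ≡ b → a ≈ b
  ≈-reflexive refl = ≈-refl

  ≈-sym : ∀ {a b} → a ≈ b → b ≈ a
  ≈-sym {a} {b} (by-difference a-b∈) = by-difference (∈-resp (flip a b) (*-closed -1ℤ a-b∈))
    where
    flip : ∀ a b → -1ℤ * (a - b) ≡ b - a
    flip = solve-∀

  ≈-trans : ∀ {a b c} → a ≈ b → b ≈ c → a ≈ c
  ≈-trans {a} {b} {c} (by-difference a-b∈) (by-difference b-c∈) =
    by-difference (∈-resp (telescope a b c) (+-closed a-b∈ b-c∈))
    where
    telescope : ∀ a b c → a - b + (b - c) ≡ a - c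
    telescope = solve-∀

  +-cong : ∀ {a a′ b b′} → a ≈ a′ → b ≈ b′ → a + b ≈ a′ + b′
  +-cong {a} {a′} {b} {b′} (by-difference p) (by-difference q) =
    by-difference (∈-resp (regroup a a′ b b′) (+-closed p q))
    where
    regroup : ∀ a a′ b b′ → a - a′ + (b - b′) ≡ a + b - (a′ + b′)
    regroup = solve-∀

  *-cong : ∀ {a a′ b b′} → a ≈ a′ → b ≈ b′ → a * b ≈ a′ * b′
  *-cong {a} {a′} {b} {b′} (by-difference p) (by-difference q) =
    by-difference (∈-resp (expand a a′ b b′) (combination-closed b a′ p q))
    where
    expand : ∀ a a′ b b′ → b * (a - a′) + a′ * (b - b′) ≡ a * b - a′ * b′
    expand = solve-∀

  +-congˡ : ∀ a {b b′} → b ≈ b′ → a + b ≈ a + b′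
  +-congˡ a b≈b′ = +-cong (≈-refl {a}) b≈b′

  +-congʳ : ∀ b {a a′} → a ≈ a′ → a + b ≈ a′ + b
  +-congʳ b a≈a′ = +-cong a≈a′ (≈-refl {b})

  *-congˡ : ∀ a {b b′} → b ≈ b′ → a * b ≈ a * b′
  *-congˡ a b≈b′ = *-cong (≈-refl {a}) b≈b′

  *-congʳ : ∀ b {a a′} → a ≈ a′ → a * b ≈ a′ * b
  *-congʳ b a≈a′ = *-cong a≈a′ (≈-refl {b})

  ∈⇒≈0 : ∀ {a} → I a → a ≈ 0ℤ
  ∈⇒≈0 {a} a∈ = by-difference (∈-resp (sym (ℤ.+-identityʳ a)) a∈)

  ≈0⇒∈ : ∀ {a} → a ≈ 0ℤ → I a
  ≈0⇒∈ {a} (by-difference a-0∈) = ∈-resp (ℤ.+-identityʳ a) a-0∈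

  ≈-setoid : Setoid _ _
  ≈-setoid = record
    { Carrier = ℤ ; _≈_ = _≈_
    ; isEquivalence = record { refl = ≈-refl ; sym = ≈-sym ; trans = ≈-trans } }

  gcd-closed : ∀ {a b} → I (+ a) → I (+ b) → I (+ gcd a b)
  gcd-closed {a} {b} a∈ b∈ with GCD.Bézout.identity (GCD.gcd-GCD a b)
  ... | GCD.Bézout.+- x y eq = ∈-resp (bézout-ℤ a b x y (gcd a b) eq) (combination-closed (+ x) (- + y) a∈ b∈)
  ... | GCD.Bézout.-+ x y eq = ∈-resp (trans (ℤ.+-comm (- + x * + a) (+ y * + b)) (bézout-ℤ b a y x (gcd a b) eq))
                                      (combination-closed (- + x) (+ y) a∈ b∈)

  gcdVec-closed : ∀ {n} (as : Vec ℕ n) → All (λ a → I (+ a)) as → I (+ gcdVec as)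
  gcdVec-closed []       []          = 0∈
  gcdVec-closed (a ∷ as) (a∈ ∷ as∈) = gcd-closed a∈ (gcdVec-closed as as∈)

∣-ideal : ∀ d → IsIdeal (d ∣ℤ_)
∣-ideal d = record
  { 0∈       = divides 0ℤ (sym (ℤ.*-zeroˡ d))
  ; +-closed = ∣m∣n⇒∣m+n
  ; *-closed = ∣n⇒∣m*n
  }

gcdVec-∣ : ∀ {n} (as : Vec ℕ n) → All (gcdVec as ∣_) as
gcdVec-∣ []       = []
gcdVec-∣ (a ∷ as) = GCD.gcd[m,n]∣m a (gcdVec as) ∷ All.map (ℕD.∣-trans (GCD.gcd[m,n]∣n a (gcdVec as))) (gcdVec-∣ as)

∣-gcdVec : ∀ {n d} (as : Vec ℕ n) → All (d ∣_) as → d ∣ gcdVec as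
∣-gcdVec []       []          = _ ℕD.∣0
∣-gcdVec (a ∷ as) (d∣a ∷ d∣as) = GCD.gcd-greatest d∣a (∣-gcdVec as d∣as)

+m-2≡+[m∸2] : ∀ {m} → 2 ≤ m → + m - + 2 ≡ + (m ∸ 2)
+m-2≡+[m∸2] {m} 2≤m = trans (ℤ.[+m]-[+n]≡m⊖n m 2) (ℤ.⊖-≥ 2≤m)

excesses-∣ : ∀ {n d} {ms : Vec ℕ n} → All (2 ≤_) ms → All (d ∣_) (map (_∸ 2) ms) → All (λ m → + d ∣ℤ + m - + 2) ms
excesses-∣ {d = d} ms≥2 d∣ =
  All.map (λ (2≤m , d∣m-2) → subst (+ d ∣ℤ_) (sym (+m-2≡+[m∸2] 2≤m)) (∣ᵤ⇒∣ d∣m-2)) (All.zip (ms≥2 , All⁺.map⁻ d∣))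

excesses-closed : ∀ {I : ℤ → Set} {n} {ms : Vec ℕ n} → All (2 ≤_) ms → All (λ m → I (+ m - + 2)) ms
  → All (λ a → I (+ a)) (map (_∸ 2) ms)
excesses-closed {I} ms≥2 ms-2∈ = All⁺.map⁺ (All.map (λ (2≤m , m-2∈) → subst I (+m-2≡+[m∸2] 2≤m) m-2∈) (All.zip (ms≥2 , ms-2∈)))

gcd-two-excesses : ∀ {n} {ms : Vec ℕ n} → All (2 ≤_) ms
  → gcdVec (2 ∷ map (_∸ 2) ms) ≤ 2 × (gcdVec (2 ∷ map (_∸ 2) ms) ≡ 2 ⇔ All (2 ∣_) ms)
gcd-two-excesses {ms = ms} ms≥2 = ℕD.∣⇒≤ μ∣2 , mk⇔ all-even (λ even → ℕD.∣-antisym μ∣2 (2∣μ even))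
  where
  G : ℕ
  G = gcdVec (map (_∸ 2) ms)
  μ∣2 : gcd 2 G ∣ 2
  μ∣2 = GCD.gcd[m,n]∣m 2 G
  all-even : gcd 2 G ≡ 2 → All (2 ∣_) ms
  all-even μ≡2 = All.map (λ (2≤m , 2∣m-2) → ℕD.∣m∸n∣n⇒∣m 2 2≤m 2∣m-2 ℕD.∣-refl)
    (All.zip (ms≥2 , All⁺.map⁻ (All.map (ℕD.∣-trans (subst (_∣ G) μ≡2 (GCD.gcd[m,n]∣n 2 G))) (gcdVec-∣ (map (_∸ 2) ms)))))
  2∣μ : All (2 ∣_) ms → 2 ∣ gcd 2 G
  2∣μ even = GCD.gcd-greatest ℕD.∣-refl (∣-gcdVec (map (_∸ 2) ms) (All⁺.map⁺ (All.map
    (λ (2≤m , 2∣m) → ℕD.∣m+n∣m⇒∣n (subst (2 ∣_) (sym (ℕP.m+[n∸m]≡n 2≤m)) 2∣m) ℕD.∣-refl) (All.zip (ms≥2 , even)))))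

-- The row lattice and its Hermite normal form

module _ (Γ : Graph) where

  δ : V Γ → V Γ → ℤ
  δ u w = 𝟙 (_≟_ Γ w u)

  α : V Γ → V Γ → ℤ
  α u w = 𝟙 (adj? Γ u w)

  δ-refl : ∀ u → δ u u ≡ 1ℤ
  δ-refl u = 𝟙-yes (_≟_ Γ u u) refl

  δ-≢ : ∀ {u w} → w ≢ u → δ u w ≡ 0ℤ
  δ-≢ {u} {w} = 𝟙-no (_≟_ Γ w u)

  δ-sym : ∀ u w → δ u w ≡ δ w u
  δ-sym u w = 𝟙-cong (mk⇔ sym sym) (_≟_ Γ w u) (_≟_ Γ u w)

  combination : List (ℤ × Row Γ) → V Γ → ℤ
  combination l w = List.foldr (λ (c , r) acc → c * row Γ r w + acc) 0ℤ l

  span-≗ : ∀ {x y} → (∀ w → x w ≡ y w) → InRowSpan Γ x → InRowSpan Γ y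
  span-≗ x≗y (l , x≗l) = l , λ w → trans (sym (x≗y w)) (x≗l w)

  span-0 : InRowSpan Γ (λ _ → 0ℤ)
  span-0 = [] , λ _ → refl

  span-row : ∀ r → InRowSpan Γ (row Γ r)
  span-row r = (1ℤ , r) ∷ [] , λ w → sym (trans (ℤ.+-identityʳ _) (ℤ.*-identityˡ _))

  combination-++ : ∀ l l′ w → combination (l ++ l′) w ≡ combination l w + combination l′ w
  combination-++ []            l′ w = sym (ℤ.+-identityˡ _)
  combination-++ ((c , r) ∷ l) l′ w =
    trans (cong (_+_ (c * row Γ r w)) (combination-++ l l′ w)) (sym (ℤ.+-assoc (c * row Γ r w) (combination l w) (combination l′ w)))

  span-+ : ∀ {x y} → InRowSpan Γ x → InRowSpan Γ y → InRowSpan Γ (λ w → x w + y w)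
  span-+ (l , x≗l) (l′ , y≗l′) =
    l ++ l′ , λ w → trans (cong₂ _+_ (x≗l w) (y≗l′ w)) (sym (combination-++ l l′ w))

  combination-scale : ∀ k l w → combination (List.map (λ (c , r) → k * c , r) l) w ≡ k * combination l w
  combination-scale k []            w = sym (ℤ.*-zeroʳ k)
  combination-scale k ((c , r) ∷ l) w =
    trans (cong₂ _+_ (ℤ.*-assoc k c _) (combination-scale k l w)) (sym (ℤ.*-distribˡ-+ k _ _))

  span-* : ∀ k {x} → InRowSpan Γ x → InRowSpan Γ (λ w → k * x w)
  span-* k (l , x≗l) =
    List.map (λ (c , r) → k * c , r) l , λ w → trans (cong (k *_) (x≗l w)) (sym (combination-scale k l w))

  span-difference : ∀ {x y} → InRowSpan Γ x → InRowSpan Γ y → InRowSpan Γ (λ w → x w - y w)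
  span-difference {x} {y} x∈ y∈ = span-≗ (λ w → cong (_+_ (x w)) (ℤ.-1*i≡-i (y w))) (span-+ x∈ (span-* -1ℤ y∈))

  span-∑ : (as : List A) {g : A → V Γ → ℤ} → (∀ a → InRowSpan Γ (g a))
    → InRowSpan Γ (λ w → ∑[ a ∈ as ] g a w)
  span-∑ []       g∈ = span-0
  span-∑ (a ∷ as) g∈ = span-+ (g∈ a) (span-∑ as g∈)

  HNFEntry : ∀ {N} → Fin N ⤖ V Γ → Fin N → ℕ → Set
  HNFEntry σ i k = 1 ≤ k
    × (Σ (V Γ → ℤ) λ x → InRowSpan Γ x
         × (∀ j → j <ᶠ i → x (Bijection.to σ j) ≡ 0ℤ)
         × x (Bijection.to σ i) ≡ + k)
    × (∀ x → InRowSpan Γ x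
         → (∀ j → j <ᶠ i → x (Bijection.to σ j) ≡ 0ℤ)
         → (+ k) ∣ᵤ x (Bijection.to σ i))

  to-≢ : ∀ {N} (σ : Fin N ⤖ V Γ) {j k} → toℕ j ≢ toℕ k → Bijection.to σ j ≢ Bijection.to σ k
  to-≢ σ j≢k tj≡tk = j≢k (cong toℕ (Bijection.injective σ tj≡tk))

  lastEntry : ∀ {N μ} (σ : Fin N ⤖ V Γ) i → suc (toℕ i) ≡ N → 1 ≤ μ
    → (∀ v → InRowSpan Γ (λ z → + μ * δ v z))
    → (∀ x v → InRowSpan Γ x → (∀ w → w ≢ v → x w ≡ 0ℤ) → + μ ∣ℤ x v)
    → HNFEntry σ i μ
  lastEntry {μ = μ} σ i i-last 1≤μ μδ∈ supported∣ = 1≤μ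
    , ((λ z → + μ * δ (to i) z) , μδ∈ (to i)
      , (λ j j<i → trans (cong (+ μ *_) (δ-≢ (to-≢ σ (ℕP.<⇒≢ j<i)))) (ℤ.*-zeroʳ (+ μ)))
      , trans (cong (+ μ *_) (δ-refl (to i))) (ℤ.*-identityʳ (+ μ)))
    , λ x x∈ earlier-0 → ∣⇒∣ᵤ (supported∣ x (to i) x∈ (vanishes x earlier-0))
    where
    open Bijection σ using (to; strictlySurjective)
    vanishes : ∀ x → (∀ j → j <ᶠ i → x (to j) ≡ 0ℤ) → ∀ w → w ≢ to i → x w ≡ 0ℤ
    vanishes x earlier-0 w w≢ti with strictlySurjective w
    ... | j , tj≡w with ℕP.m≤n⇒m<n∨m≡n (ℕP.≤-pred (subst (toℕ j ℕ.<_) (sym i-last) (FinP.toℕ<n j)))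
    ...   | inj₁ j<i = trans (sym (cong x tj≡w)) (earlier-0 j j<i)
    ...   | inj₂ j≡i = contradiction (trans (sym tj≡w) (cong to (FinP.toℕ-injective j≡i))) w≢ti

  innerEntry : ∀ {N} (σ : Fin (suc N) ⤖ V Γ) i → suc (toℕ i) ≢ suc N
    → (∀ v w → ∃ λ s → InRowSpan Γ (λ z → δ v z - s * δ w z))
    → HNFEntry σ i 1
  innerEntry {N} σ i i-not-last δ-δ∈ = ℕP.≤-refl , (x , x∈ , earlier-0 , at-i) , λ y _ _ → ℕD.1∣ _
    where
    open Bijection σ using (to)
    i<N : toℕ i ℕ.< toℕ (fromℕ N)
    i<N = subst (toℕ i ℕ.<_) (sym (FinP.toℕ-fromℕ N)) (ℕP.≤∧≢⇒< (ℕP.≤-pred (FinP.toℕ<n i)) (i-not-last ∘ cong suc))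
    s : ℤ
    s = proj₁ (δ-δ∈ (to i) (to (fromℕ N)))
    x : V Γ → ℤ
    x z = δ (to i) z - s * δ (to (fromℕ N)) z
    x∈ : InRowSpan Γ x
    x∈ = proj₂ (δ-δ∈ (to i) (to (fromℕ N)))
    earlier-0 : ∀ j → j <ᶠ i → x (to j) ≡ 0ℤ
    earlier-0 j j<i = begin
      δ (to i) (to j) - s * δ (to (fromℕ N)) (to j)
        ≡⟨ cong₂ (λ a b → a - s * b) (δ-≢ (to-≢ σ (ℕP.<⇒≢ j<i))) (δ-≢ (to-≢ σ (ℕP.<⇒≢ (ℕP.<-trans j<i i<N)))) ⟩
      0ℤ - s * 0ℤ   ≡⟨ cong (_-_ 0ℤ) (ℤ.*-zeroʳ s) ⟩
      0ℤ            ∎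
      where open ≡-Reasoning
    at-i : x (to i) ≡ + 1
    at-i = begin
      δ (to i) (to i) - s * δ (to (fromℕ N)) (to i)
        ≡⟨ cong₂ (λ a b → a - s * b) (δ-refl (to i)) (δ-≢ (to-≢ σ (ℕP.<⇒≢ i<N))) ⟩
      1ℤ - s * 0ℤ   ≡⟨ cong (_-_ 1ℤ) (ℤ.*-zeroʳ s) ⟩
      1ℤ            ∎
      where open ≡-Reasoning

  isRA-fromLattice : ∀ {μ} → 1 ≤ μ
    → (∀ v w → ∃ λ s → InRowSpan Γ (λ z → δ v z - s * δ w z))
    → (∀ v → InRowSpan Γ (λ z → + μ * δ v z))
    → (∀ x v → InRowSpan Γ x → (∀ w → w ≢ v → x w ≡ 0ℤ) → + μ ∣ℤ x v)
    → IsRA μ Γ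
  isRA-fromLattice {μ} 1≤μ δ-δ∈ μδ∈ supported∣ = 1≤μ , entry
    where
    entry : ∀ N (σ : Fin N ⤖ V Γ) i → HNFEntry σ i (onesThen N μ i)
    entry (suc N) σ i with suc (toℕ i) ℕ.≡ᵇ suc N in eq
    ... | true  = lastEntry σ i (ℕP.≡ᵇ⇒≡ (suc (toℕ i)) (suc N) (subst T (sym eq) _)) 1≤μ μδ∈ supported∣
    ... | false = innerEntry σ i (λ i-last → subst T eq (ℕP.≡⇒≡ᵇ (suc (toℕ i)) (suc N) i-last)) δ-δ∈

-- E lists each vertex exactly once, expressed as the sifting property of δ.
IsEnumeration : (Γ : Graph) → List (V Γ) → Set
IsEnumeration Γ E = ∀ u (f : V Γ → ℤ) → ∑[ w ∈ E ] (δ Γ u w * f w) ≡ f u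

module SignCriterion (Γ : Graph) (E : List (V Γ)) (E-enum : IsEnumeration Γ E)
  (ε : V Γ → ℤ) (ε-unit : ∀ v → ε v * ε v ≡ 1ℤ) (v₀ : V Γ)
  (linked : ∀ w → InRowSpan Γ (λ z → δ Γ w z - ε w * δ Γ v₀ z)) where

  φ : (V Γ → ℤ) → ℤ
  φ x = ∑[ w ∈ E ] (ε w * x w)

  φ-cong : ∀ {x y} → (∀ w → x w ≡ y w) → φ x ≡ φ y
  φ-cong x≗y = ∑-cong E (λ w → cong (ε w *_) (x≗y w))

  φ-linear : ∀ c x y → φ (λ w → c * x w + y w) ≡ c * φ x + φ y
  φ-linear c x y = begin
    ∑[ w ∈ E ] (ε w * (c * x w + y w))       ≡⟨ ∑-cong E (λ w → distrib (ε w) c (x w) (y w)) ⟩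
    ∑[ w ∈ E ] (c * (ε w * x w) + ε w * y w) ≡⟨ ∑-+ E _ _ ⟩
    ∑[ w ∈ E ] (c * (ε w * x w)) + φ y       ≡⟨ cong (_+ φ y) (∑-*ˡ E c (λ w → ε w * x w)) ⟩
    c * φ x + φ y                            ∎
    where
    open ≡-Reasoning
    distrib : ∀ e c x y → e * (c * x + y) ≡ c * (e * x) + e * y
    distrib = solve-∀

  φ-supported : ∀ x v → (∀ w → w ≢ v → x w ≡ 0ℤ) → φ x ≡ ε v * x v
  φ-supported x v off-v = trans (∑-cong E sift) (E-enum v (λ w → ε w * x w))
    where
    sift : ∀ w → ε w * x w ≡ δ Γ v w * (ε w * x w)
    sift w with _≟_ Γ w v
    ... | yes _   = sym (ℤ.*-identityˡ _)
    ... | no w≢v = trans (cong (ε w *_) (off-v w w≢v)) (ℤ.*-zeroʳ (ε w))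

  φ-span-∣ : ∀ {d x} → (∀ r → d ∣ℤ φ (row Γ r)) → InRowSpan Γ x → d ∣ℤ φ x
  φ-span-∣ {d} rows∣ (l , x≗l) = subst (d ∣ℤ_) (sym (φ-cong x≗l)) (combination∣ l)
    where
    combination∣ : ∀ l → d ∣ℤ φ (combination Γ l)
    combination∣ []            = subst (d ∣ℤ_) (sym (trans (∑-cong E (λ w → ℤ.*-zeroʳ (ε w))) (∑-zero E)))
                                       (divides 0ℤ (sym (ℤ.*-zeroˡ d)))
    combination∣ ((c , r) ∷ l) = subst (d ∣ℤ_) (sym (φ-linear c (row Γ r) (combination Γ l)))
                                       (∣m∣n⇒∣m+n (∣n⇒∣m*n c (rows∣ r)) (combination∣ l))

  BaseIdeal : ℤ → Set
  BaseIdeal c = InRowSpan Γ (λ z → c * δ Γ v₀ z)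

  baseIdeal : IsIdeal BaseIdeal
  baseIdeal = record
    { 0∈       = span-≗ Γ (λ z → sym (ℤ.*-zeroˡ (δ Γ v₀ z))) (span-0 Γ)
    ; +-closed = λ {a} {b} a∈ b∈ → span-≗ Γ (λ z → sym (ℤ.*-distribʳ-+ (δ Γ v₀ z) a b)) (span-+ Γ a∈ b∈)
    ; *-closed = λ c {a} a∈ → span-≗ Γ (λ z → sym (ℤ.*-assoc c a (δ Γ v₀ z))) (span-* Γ c a∈)
    }

  -- x − φ x · δ v₀ = Σ_w x_w (δ w − ε w δ v₀).
  φ∈BaseIdeal : ∀ {x} → InRowSpan Γ x → BaseIdeal (φ x)
  φ∈BaseIdeal {x} x∈ = span-≗ Γ residual (span-difference Γ x∈ (span-∑ Γ E (λ w → span-* Γ (x w) (linked w))))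
    where
    expand : ∀ z → ∑[ w ∈ E ] (x w * (δ Γ w z - ε w * δ Γ v₀ z)) ≡ x z + - δ Γ v₀ z * φ x
    expand z = begin
      ∑[ w ∈ E ] (x w * (δ Γ w z - ε w * δ Γ v₀ z))
        ≡⟨ ∑-cong E (λ w → trans (cong (λ t → x w * (t - ε w * δ Γ v₀ z)) (δ-sym Γ w z))
                                 (regroup (x w) (δ Γ z w) (ε w) (δ Γ v₀ z))) ⟩
      ∑[ w ∈ E ] (δ Γ z w * x w + - δ Γ v₀ z * (ε w * x w))
        ≡⟨ ∑-+ E _ _ ⟩
      ∑[ w ∈ E ] (δ Γ z w * x w) + ∑[ w ∈ E ] (- δ Γ v₀ z * (ε w * x w))
        ≡⟨ cong₂ _+_ (E-enum z x) (∑-*ˡ E (- δ Γ v₀ z) (λ w → ε w * x w)) ⟩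
      x z + - δ Γ v₀ z * φ x ∎
      where
      open ≡-Reasoning
      regroup : ∀ x d e d₀ → x * (d - e * d₀) ≡ d * x + - d₀ * (e * x)
      regroup = solve-∀
    residual : ∀ z → x z - ∑[ w ∈ E ] (x w * (δ Γ w z - ε w * δ Γ v₀ z)) ≡ φ x * δ Γ v₀ z
    residual z = trans (cong (_-_ (x z)) (expand z)) (cancel (x z) (δ Γ v₀ z) (φ x))
      where
      cancel : ∀ x d p → x - (x + - d * p) ≡ p * d
      cancel = solve-∀

  isRA-bySign : ∀ {μ} → 1 ≤ μ → BaseIdeal (+ μ) → (∀ r → + μ ∣ℤ φ (row Γ r)) → IsRA μ Γ
  isRA-bySign {μ} 1≤μ μ∈ rows∣ = isRA-fromLattice Γ 1≤μ δ-δ∈ μδ∈ supported∣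
    where
    δ-δ∈ : ∀ v w → ∃ λ s → InRowSpan Γ (λ z → δ Γ v z - s * δ Γ w z)
    δ-δ∈ v w = ε v * ε w , span-≗ Γ cancel (span-difference Γ (linked v) (span-* Γ (ε v * ε w) (linked w)))
      where
      cancel : ∀ z → δ Γ v z - ε v * δ Γ v₀ z - ε v * ε w * (δ Γ w z - ε w * δ Γ v₀ z)
                     ≡ δ Γ v z - ε v * ε w * δ Γ w z
      cancel z = begin
        δ Γ v z - ε v * δ Γ v₀ z - ε v * ε w * (δ Γ w z - ε w * δ Γ v₀ z)
          ≡⟨ expand (δ Γ v z) (δ Γ w z) (δ Γ v₀ z) (ε v) (ε w) ⟩
        δ Γ v z - ε v * ε w * δ Γ w z + ε v * (ε w * ε w - 1ℤ) * δ Γ v₀ z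
          ≡⟨ cong (λ t → δ Γ v z - ε v * ε w * δ Γ w z + ε v * (t - 1ℤ) * δ Γ v₀ z) (ε-unit w) ⟩
        δ Γ v z - ε v * ε w * δ Γ w z + ε v * (1ℤ - 1ℤ) * δ Γ v₀ z
          ≡⟨ drop (δ Γ v z) (δ Γ w z) (δ Γ v₀ z) (ε v) (ε w) ⟩
        δ Γ v z - ε v * ε w * δ Γ w z ∎
        where
        open ≡-Reasoning
        expand : ∀ a b d e f → a - e * d - e * f * (b - f * d) ≡ a - e * f * b + e * (f * f - 1ℤ) * d
        expand = solve-∀
        drop : ∀ a b d e f → a - e * f * b + e * (1ℤ - 1ℤ) * d ≡ a - e * f * b
        drop = solve-∀
    μδ∈ : ∀ v → InRowSpan Γ (λ z → + μ * δ Γ v z)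
    μδ∈ v = span-≗ Γ (λ z → recombine (+ μ) (δ Γ v z) (ε v) (δ Γ v₀ z))
                   (span-+ Γ (span-* Γ (+ μ) (linked v)) (span-* Γ (ε v) μ∈))
      where
      recombine : ∀ m d e d₀ → m * (d - e * d₀) + e * (m * d₀) ≡ m * d
      recombine = solve-∀
    supported∣ : ∀ x v → InRowSpan Γ x → (∀ w → w ≢ v → x w ≡ 0ℤ) → + μ ∣ℤ x v
    supported∣ x v x∈ off-v = subst (+ μ ∣ℤ_) unsign (∣n⇒∣m*n (ε v) (subst (+ μ ∣ℤ_) (φ-supported x v off-v) (φ-span-∣ rows∣ x∈)))
      where
      unsign : ε v * (ε v * x v) ≡ x v
      unsign = trans (sym (ℤ.*-assoc (ε v) (ε v) (x v))) (trans (cong (_* x v) (ε-unit v)) (ℤ.*-identityˡ (x v)))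

-- Twins and closed neighbourhoods

record TwinsOutside (Γ : Graph) (u v v′ : V Γ) : Set where
  field
    v≢u   : v ≢ u
    v′≢u  : v′ ≢ u
    agree : ∀ w → ¬ Adj Γ u w → Adj Γ v w ⇔ Adj Γ v′ w

Twin : (Γ : Graph) → V Γ → V Γ → Set
Twin Γ v v′ = ∃ λ u → TwinsOutside Γ u v v′

FarTwin : (Γ : Graph) → V Γ → V Γ → Set
FarTwin Γ v v′ = ∃ λ u → TwinsOutside Γ u v v′ × ¬ Adj Γ u v × ¬ Adj Γ u v′

farTwin⇒twin : ∀ {Γ v v′} → FarTwin Γ v v′ → Twin Γ v v′
farTwin⇒twin (u , twins , _) = u , twins

common : (Γ : Graph) → List (V Γ) → (V Γ → ℤ) → V Γ → V Γ → ℤ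
common Γ E ε u v = ∑[ w ∈ E ] (ε w * (α Γ u w * α Γ v w))

module Loopless (Γ : Graph) (irreflexive : ∀ v → ¬ Adj Γ v v) where

  N[_] : V Γ → V Γ → ℤ
  N[ v ] = row Γ (inj₁ v)

  N[]-split : ∀ v w → N[ v ] w ≡ δ Γ v w + α Γ v w
  N[]-split v w = 𝟙-⊎ (λ (w≡v , v~w) → irreflexive v (subst (Adj Γ v) w≡v v~w)) (_≟_ Γ w v) (adj? Γ v w)

  meet-row : ∀ u v w → row Γ (inj₂ (u , v)) w ≡ N[ u ] w * N[ v ] w
  meet-row u v w = 𝟙-× (inN? Γ u w) (inN? Γ v w)

  -- N[v] − N[v′] − (N[u] ∩ N[v]) + (N[u] ∩ N[v′]) = (N[v] − N[v′]) · (1 − N[u]) = δ v − δ v′.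
  twins-δ-difference : ∀ {u v v′} → TwinsOutside Γ u v v′ → ¬ Adj Γ u v → ¬ Adj Γ u v′
    → InRowSpan Γ (λ z → δ Γ v z - δ Γ v′ z)
  twins-δ-difference {u} {v} {v′} twins u≁v u≁v′ =
    span-≗ Γ pointwise (span-difference Γ (span-difference Γ (span-row Γ (inj₁ v)) (span-row Γ (inj₁ v′)))
                                 (span-difference Γ (span-row Γ (inj₂ (u , v))) (span-row Γ (inj₂ (u , v′)))))
    where
    open TwinsOutside twins
    outside : ∀ {x} → x ≢ u → ¬ Adj Γ u x → ∀ w → w ≡ u ⊎ Adj Γ u w → δ Γ x w ≡ 0ℤ
    outside x≢u u≁x w w∈N[u] = δ-≢ Γ λ { refl → [ x≢u , u≁x ]′ w∈N[u] }
    factor : ∀ w (w∈N[u]? : Dec (w ≡ u ⊎ Adj Γ u w))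
      → δ Γ v w - δ Γ v′ w ≡ (N[ v ] w - N[ v′ ] w) * (1ℤ - 𝟙 w∈N[u]?)
    factor w (yes w∈N[u]) = begin
      δ Γ v w - δ Γ v′ w                            ≡⟨ cong₂ _-_ (outside v≢u u≁v w w∈N[u]) (outside v′≢u u≁v′ w w∈N[u]) ⟩
      0ℤ                                            ≡⟨ ℤ.*-zeroʳ (N[ v ] w - N[ v′ ] w) ⟨
      (N[ v ] w - N[ v′ ] w) * 0ℤ                   ∎
      where open ≡-Reasoning
    factor w (no w∉N[u]) = begin
      δ Γ v w - δ Γ v′ w                             ≡⟨ cancel (δ Γ v w) (δ Γ v′ w) (α Γ v w) ⟩
      δ Γ v w + α Γ v w - (δ Γ v′ w + α Γ v w)       ≡⟨ cong (λ a → δ Γ v w + α Γ v w - (δ Γ v′ w + a))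
                                                          (𝟙-cong (agree w (w∉N[u] ∘ inj₂)) (adj? Γ v w) (adj? Γ v′ w)) ⟩
      δ Γ v w + α Γ v w - (δ Γ v′ w + α Γ v′ w)      ≡⟨ cong₂ _-_ (N[]-split v w) (N[]-split v′ w) ⟨
      N[ v ] w - N[ v′ ] w                           ≡⟨ ℤ.*-identityʳ _ ⟨
      (N[ v ] w - N[ v′ ] w) * 1ℤ                    ∎
      where
      open ≡-Reasoning
      cancel : ∀ d d′ a → d - d′ ≡ d + a - (d′ + a)
      cancel = solve-∀
    pointwise : ∀ w → N[ v ] w - N[ v′ ] w - (row Γ (inj₂ (u , v)) w - row Γ (inj₂ (u , v′)) w)
                      ≡ δ Γ v w - δ Γ v′ w
    pointwise w = begin
      N[ v ] w - N[ v′ ] w - (row Γ (inj₂ (u , v)) w - row Γ (inj₂ (u , v′)) w)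
        ≡⟨ cong₂ (λ a b → N[ v ] w - N[ v′ ] w - (a - b)) (meet-row u v w) (meet-row u v′ w) ⟩
      N[ v ] w - N[ v′ ] w - (N[ u ] w * N[ v ] w - N[ u ] w * N[ v′ ] w)
        ≡⟨ regroup (N[ v ] w) (N[ v′ ] w) (N[ u ] w) ⟩
      (N[ v ] w - N[ v′ ] w) * (1ℤ - N[ u ] w)
        ≡⟨ factor w (inN? Γ u w) ⟨
      δ Γ v w - δ Γ v′ w ∎
      where
      open ≡-Reasoning
      regroup : ∀ a b c → a - b - (c * a - c * b) ≡ (a - b) * (1ℤ - c)
      regroup = solve-∀

  adjacent-δ-sum : ∀ {u v} → Adj Γ u v → Adj Γ v u → (∀ w → ¬ (Adj Γ u w × Adj Γ v w))
    → InRowSpan Γ (λ z → δ Γ u z + δ Γ v z)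
  adjacent-δ-sum {u} {v} u~v v~u no-common = span-≗ Γ pointwise (span-row Γ (inj₂ (u , v)))
    where
    v≢u : v ≢ u
    v≢u refl = irreflexive v u~v
    pointwise : ∀ w → row Γ (inj₂ (u , v)) w ≡ δ Γ u w + δ Γ v w
    pointwise w = by-cases (_≟_ Γ w u) (_≟_ Γ w v)
      where
      no-common-member : w ≢ u → w ≢ v → ¬ ((w ≡ u ⊎ Adj Γ u w) × (w ≡ v ⊎ Adj Γ v w))
      no-common-member w≢u w≢v (inj₁ w≡u , _)        = w≢u w≡u
      no-common-member w≢u w≢v (inj₂ _ , inj₁ w≡v)   = w≢v w≡v
      no-common-member w≢u w≢v (inj₂ u~w , inj₂ v~w) = no-common w (u~w , v~w)
      by-cases : Dec (w ≡ u) → Dec (w ≡ v) → row Γ (inj₂ (u , v)) w ≡ δ Γ u w + δ Γ v w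
      by-cases (yes refl) (yes refl) = contradiction refl v≢u
      by-cases (yes refl) (no w≢v)   = trans (𝟙-yes (inN? Γ u w ×-dec inN? Γ v w) (inj₁ refl , inj₂ v~u))
                                             (sym (cong₂ _+_ (δ-refl Γ w) (δ-≢ Γ w≢v)))
      by-cases (no w≢u)   (yes refl) = trans (𝟙-yes (inN? Γ u w ×-dec inN? Γ v w) (inj₂ u~v , inj₁ refl))
                                             (sym (cong₂ _+_ (δ-≢ Γ w≢u) (δ-refl Γ w)))
      by-cases (no w≢u)   (no w≢v)   = trans (𝟙-no (inN? Γ u w ×-dec inN? Γ v w) (no-common-member w≢u w≢v))
                                             (sym (cong₂ _+_ (δ-≢ Γ w≢u) (δ-≢ Γ w≢v)))

  farTwinned-δ-difference : ∀ {v v′} → Plus (FarTwin Γ) v v′ → InRowSpan Γ (λ z → δ Γ v z - δ Γ v′ z)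
  farTwinned-δ-difference [ _ , twins , u≁v , u≁v′ ] = twins-δ-difference twins u≁v u≁v′
  farTwinned-δ-difference {v} {v″} (_ ∼⁺⟨ v⁺v′ ⟩ v′⁺v″) =
    span-≗ Γ (λ z → telescope (δ Γ v z) _ (δ Γ v″ z))
      (span-+ Γ (farTwinned-δ-difference v⁺v′) (farTwinned-δ-difference v′⁺v″))
    where
    telescope : ∀ a b c → a - b + (b - c) ≡ a - c
    telescope = solve-∀

  module _ (E : List (V Γ)) (E-enum : IsEnumeration Γ E) (ε : V Γ → ℤ) where

    φ-N[] : ∀ v → ∑[ w ∈ E ] (ε w * N[ v ] w) ≡ ε v + common Γ E ε v v
    φ-N[] v = begin
      ∑[ w ∈ E ] (ε w * N[ v ] w)
        ≡⟨ ∑-cong E (λ w → trans (cong (ε w *_) (N[]-split v w))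
                                 (trans (expand (ε w) (δ Γ v w) (α Γ v w)) (cong (λ t → δ Γ v w * ε w + ε w * t)
                                                                                 (sym (𝟙-idem (adj? Γ v w)))))) ⟩
      ∑[ w ∈ E ] (δ Γ v w * ε w + ε w * (α Γ v w * α Γ v w)) ≡⟨ ∑-+ E _ _ ⟩
      ∑[ w ∈ E ] (δ Γ v w * ε w) + common Γ E ε v v          ≡⟨ cong (_+ common Γ E ε v v) (E-enum v ε) ⟩
      ε v + common Γ E ε v v                                 ∎
      where
      open ≡-Reasoning
      expand : ∀ e d a → e * (d + a) ≡ d * e + e * a
      expand = solve-∀

    φ-meet : ∀ u v → ∑[ w ∈ E ] (ε w * row Γ (inj₂ (u , v)) w)
                     ≡ ε u * N[ v ] u + ε v * α Γ u v + common Γ E ε u v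
    φ-meet u v = begin
      ∑[ w ∈ E ] (ε w * row Γ (inj₂ (u , v)) w)
        ≡⟨ ∑-cong E (λ w → trans (cong (ε w *_) (trans (meet-row u v w) (cong (_* N[ v ] w) (N[]-split u w))))
                                 (expand (ε w) (δ Γ u w) (α Γ u w) (N[ v ] w) (δ Γ v w) (α Γ v w) (N[]-split v w))) ⟩
      ∑[ w ∈ E ] (δ Γ u w * (ε w * N[ v ] w) + (δ Γ v w * (ε w * α Γ u w) + ε w * (α Γ u w * α Γ v w)))
        ≡⟨ trans (∑-+ E (λ w → δ Γ u w * (ε w * N[ v ] w)) _)
                 (cong (_+_ (∑[ w ∈ E ] (δ Γ u w * (ε w * N[ v ] w)))) (∑-+ E (λ w → δ Γ v w * (ε w * α Γ u w)) _)) ⟩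
      ∑[ w ∈ E ] (δ Γ u w * (ε w * N[ v ] w)) + (∑[ w ∈ E ] (δ Γ v w * (ε w * α Γ u w)) + common Γ E ε u v)
        ≡⟨ cong₂ (λ p q → p + (q + common Γ E ε u v)) (E-enum u (λ w → ε w * N[ v ] w)) (E-enum v (λ w → ε w * α Γ u w)) ⟩
      ε u * N[ v ] u + (ε v * α Γ u v + common Γ E ε u v)
        ≡⟨ ℤ.+-assoc (ε u * N[ v ] u) (ε v * α Γ u v) (common Γ E ε u v) ⟨
      ε u * N[ v ] u + ε v * α Γ u v + common Γ E ε u v ∎
      where
      open ≡-Reasoning
      expand : ∀ e d a n d′ a′ → n ≡ d′ + a′ → e * ((d + a) * n) ≡ d * (e * n) + (d′ * (e * a) + e * (a * a′))
      expand e d a n d′ a′ n≡ = trans (split e d a n) (trans (cong (λ t → d * (e * n) + e * a * t) n≡) (spread d e n a d′ a′))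
        where
        split : ∀ e d a n → e * ((d + a) * n) ≡ d * (e * n) + e * a * n
        split = solve-∀
        spread : ∀ d e n a d′ a′ → d * (e * n) + e * a * (d′ + a′) ≡ d * (e * n) + (d′ * (e * a) + e * (a * a′))
        spread = solve-∀

-- Tensor products of complete graphs

module _ (Γ Λ : Graph) where

  δ-⊗ : ∀ a h c g → δ (Γ ⊗ Λ) (a , h) (c , g) ≡ δ Γ a c * δ Λ h g
  δ-⊗ a h c g = trans (𝟙-cong (mk⇔ (λ { refl → refl , refl }) (λ { (refl , refl) → refl }))
                              (_≟_ (Γ ⊗ Λ) (c , g) (a , h)) (_≟_ Γ c a ×-dec _≟_ Λ g h))
                      (𝟙-× (_≟_ Γ c a) (_≟_ Λ g h))

  α-⊗ : ∀ a h c g → α (Γ ⊗ Λ) (a , h) (c , g) ≡ α Γ a c * α Λ h g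
  α-⊗ a h c g = 𝟙-× (adj? Γ a c) (adj? Λ h g)

  ∑-⊗ : (E : List (V Γ)) (F : List (V Λ)) (f : V Γ → ℤ) (g : V Λ → ℤ)
    → ∑[ w ∈ cartesianProduct E F ] (f (proj₁ w) * g (proj₂ w)) ≡ ∑ E f * ∑ F g
  ∑-⊗ E F f g = begin
    ∑[ w ∈ cartesianProduct E F ] (f (proj₁ w) * g (proj₂ w)) ≡⟨ ∑-cartesianProduct E F _ ⟩
    ∑[ c ∈ E ] ∑[ h ∈ F ] (f c * g h)                          ≡⟨ ∑-cong E (λ c → ∑-*ˡ F (f c) g) ⟩
    ∑[ c ∈ E ] (f c * ∑ F g)                                   ≡⟨ ∑-*ʳ E (∑ F g) f ⟩
    ∑ E f * ∑ F g                                              ∎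
    where open ≡-Reasoning

  ⊗-enumeration : ∀ E F → IsEnumeration Γ E → IsEnumeration Λ F → IsEnumeration (Γ ⊗ Λ) (cartesianProduct E F)
  ⊗-enumeration E F E-enum F-enum (a , h) f = begin
    ∑[ w ∈ cartesianProduct E F ] (δ (Γ ⊗ Λ) (a , h) w * f w)  ≡⟨ ∑-cartesianProduct E F _ ⟩
    ∑[ c ∈ E ] ∑[ g ∈ F ] (δ (Γ ⊗ Λ) (a , h) (c , g) * f (c , g))
      ≡⟨ ∑-cong E (λ c → ∑-cong F (λ g → trans (cong (_* f (c , g)) (δ-⊗ a h c g))
                                               (ℤ.*-assoc (δ Γ a c) (δ Λ h g) (f (c , g))))) ⟩
    ∑[ c ∈ E ] ∑[ g ∈ F ] (δ Γ a c * (δ Λ h g * f (c , g)))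
      ≡⟨ ∑-cong E (λ c → trans (∑-*ˡ F (δ Γ a c) _) (cong (δ Γ a c *_) (F-enum h (λ g → f (c , g))))) ⟩
    ∑[ c ∈ E ] (δ Γ a c * f (c , h))                            ≡⟨ E-enum a (λ c → f (c , h)) ⟩
    f (a , h)                                                   ∎
    where open ≡-Reasoning

  common-⊗ : ∀ E F (ε : V Γ → ℤ) (η : V Λ → ℤ) (ζ : V (Γ ⊗ Λ) → ℤ) → (∀ c g → ζ (c , g) ≡ ε c * η g)
    → ∀ a h b k → common (Γ ⊗ Λ) (cartesianProduct E F) ζ (a , h) (b , k) ≡ common Γ E ε a b * common Λ F η h k
  common-⊗ E F ε η ζ ζ-split a h b k = trans (∑-cong (cartesianProduct E F) factor)
    (∑-⊗ E F (λ c → ε c * (α Γ a c * α Γ b c)) (λ g → η g * (α Λ h g * α Λ k g)))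
    where
    regroup : ∀ e n p q r s → e * n * ((p * q) * (r * s)) ≡ e * (p * r) * (n * (q * s))
    regroup = solve-∀
    factor : ∀ w → ζ w * (α (Γ ⊗ Λ) (a , h) w * α (Γ ⊗ Λ) (b , k) w)
                   ≡ ε (proj₁ w) * (α Γ a (proj₁ w) * α Γ b (proj₁ w)) * (η (proj₂ w) * (α Λ h (proj₂ w) * α Λ k (proj₂ w)))
    factor (c , g) = trans (cong₂ _*_ (ζ-split c g) (cong₂ _*_ (α-⊗ a h c g) (α-⊗ b k c g)))
                           (regroup (ε c) (η g) (α Γ a c) (α Λ h g) (α Γ b c) (α Λ k g))

α-K : ∀ {x} (a c : Fin x) → α (K x) a c ≡ 1ℤ - δ (K x) a c
α-K a c = trans (𝟙-¬ (a ≟ᶠ c)) (cong (_-_ 1ℤ) (𝟙-cong (mk⇔ sym sym) (a ≟ᶠ c) (c ≟ᶠ a)))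

allFin-enumeration : ∀ x → IsEnumeration (K x) (allFin x)
allFin-enumeration (suc x) a f =
  trans (cong (_+_ (δ (K (suc x)) a zero * f zero)) (∑-tabulate suc (λ c → δ (K (suc x)) a c * f c))) (split a)
  where
  split : ∀ a → δ (K (suc x)) a zero * f zero + ∑[ c ∈ allFin x ] (δ (K (suc x)) a (suc c) * f (suc c)) ≡ f a
  split zero    = begin
    1ℤ * f zero + ∑[ c ∈ allFin x ] (0ℤ * f (suc c)) ≡⟨ cong₂ _+_ (ℤ.*-identityˡ (f zero))
                                                              (trans (∑-cong (allFin x) (λ c → ℤ.*-zeroˡ (f (suc c))))
                                                                     (∑-zero (allFin x))) ⟩
    f zero + 0ℤ                                      ≡⟨ ℤ.+-identityʳ (f zero) ⟩
    f zero                                           ∎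
    where open ≡-Reasoning
  split (suc a) = begin
    0ℤ * f zero + ∑[ c ∈ allFin x ] (δ (K (suc x)) (suc a) (suc c) * f (suc c))
      ≡⟨ ℤ.+-identityˡ _ ⟩
    ∑[ c ∈ allFin x ] (δ (K (suc x)) (suc a) (suc c) * f (suc c))
      ≡⟨ ∑-cong (allFin x) (λ c → cong (_* f (suc c))
                 (𝟙-cong (mk⇔ FinP.suc-injective (cong suc)) (suc c ≟ᶠ suc a) (c ≟ᶠ a))) ⟩
    ∑[ c ∈ allFin x ] (δ (K x) a c * f (suc c))
      ≡⟨ allFin-enumeration x a (f ∘ suc) ⟩
    f (suc a) ∎
    where open ≡-Reasoning

∑-count : ∀ x → ∑[ c ∈ allFin x ] 1ℤ ≡ + x
∑-count 0       = refl
∑-count (suc x) = trans (cong (_+_ 1ℤ) (trans (∑-tabulate {n = x} suc (λ _ → 1ℤ)) (∑-count x))) (sym (ℤ.pos-+ 1 x))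

common-K : ∀ x (a b : Fin x) → common (K x) (allFin x) (λ _ → 1ℤ) a b ≡ + x - + 2 + δ (K x) a b
common-K x a b = begin
  ∑[ c ∈ allFin x ] (1ℤ * (α (K x) a c * α (K x) b c))
    ≡⟨ ∑-cong (allFin x) (λ c → trans (cong (λ t → 1ℤ * t) (cong₂ _*_ (α-K a c) (α-K b c))) (expand (δ′ a c) (δ′ b c))) ⟩
  ∑[ c ∈ allFin x ] (1ℤ + (-1ℤ * (δ′ a c * 1ℤ) + (-1ℤ * (δ′ b c * 1ℤ) + δ′ a c * δ′ b c)))
    ≡⟨ ∑-+ (allFin x) _ _ ⟩
  ∑[ c ∈ allFin x ] 1ℤ + ∑[ c ∈ allFin x ] (-1ℤ * (δ′ a c * 1ℤ) + (-1ℤ * (δ′ b c * 1ℤ) + δ′ a c * δ′ b c))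
    ≡⟨ cong₂ _+_ (∑-count x) (trans (∑-+ (allFin x) _ _) (cong₂ _+_ (sift a) (trans (∑-+ (allFin x) _ _)
                                                                            (cong₂ _+_ (sift b) (allFin-enumeration x a (δ′ b)))))) ⟩
  + x + (-1ℤ * 1ℤ + (-1ℤ * 1ℤ + δ′ b a))
    ≡⟨ collect (+ x) (δ′ b a) ⟩
  + x - + 2 + δ′ b a
    ≡⟨ cong (_+_ (+ x - + 2)) (δ-sym (K x) b a) ⟩
  + x - + 2 + δ′ a b ∎
  where
  open ≡-Reasoning
  δ′ : Fin x → Fin x → ℤ
  δ′ = δ (K x)
  expand : ∀ p q → 1ℤ * ((1ℤ - p) * (1ℤ - q)) ≡ 1ℤ + (-1ℤ * (p * 1ℤ) + (-1ℤ * (q * 1ℤ) + p * q))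
  expand = solve-∀
  collect : ∀ m d → m + (-1ℤ * 1ℤ + (-1ℤ * 1ℤ + d)) ≡ m - + 2 + d
  collect = solve-∀
  sift : ∀ a → ∑[ c ∈ allFin x ] (-1ℤ * (δ′ a c * 1ℤ)) ≡ -1ℤ * 1ℤ
  sift a = trans (∑-*ˡ (allFin x) -1ℤ _) (cong (-1ℤ *_) (allFin-enumeration x a (λ _ → 1ℤ)))

vertices : ∀ {n} (ms : Vec ℕ (suc n)) → List (V (prodK ms))
vertices (x ∷ [])     = allFin x
vertices (x ∷ y ∷ ys) = cartesianProduct (allFin x) (vertices (y ∷ ys))

vertices-enumeration : ∀ {n} (ms : Vec ℕ (suc n)) → IsEnumeration (prodK ms) (vertices ms)
vertices-enumeration (x ∷ [])     = allFin-enumeration x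
vertices-enumeration (x ∷ y ∷ ys) =
  ⊗-enumeration (K x) (prodK (y ∷ ys)) (allFin x) (vertices (y ∷ ys)) (allFin-enumeration x) (vertices-enumeration (y ∷ ys))

prodK-irreflexive : ∀ {n} (ms : Vec ℕ (suc n)) v → ¬ Adj (prodK ms) v v
prodK-irreflexive (x ∷ [])     a       a≢a       = a≢a refl
prodK-irreflexive (x ∷ y ∷ ys) (a , _) (a≢a , _) = a≢a refl

prodK-symmetric : ∀ {n} (ms : Vec ℕ (suc n)) {u v} → Adj (prodK ms) u v → Adj (prodK ms) v u
prodK-symmetric (x ∷ [])     a≢b         = a≢b ∘ sym
prodK-symmetric (x ∷ y ∷ ys) (a≢b , h~k) = a≢b ∘ sym , prodK-symmetric (y ∷ ys) h~k

α-sym : ∀ {n} (ms : Vec ℕ (suc n)) u v → α (prodK ms) u v ≡ α (prodK ms) v u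
α-sym ms u v = 𝟙-cong (mk⇔ (prodK-symmetric ms) (prodK-symmetric ms)) (adj? (prodK ms) u v) (adj? (prodK ms) v u)

≥3⇒≥2 : ∀ {n} {ms : Vec ℕ n} → All (3 ≤_) ms → All (2 ≤_) ms
≥3⇒≥2 = All.map (ℕP.≤-trans (ℕP.n≤1+n 2))

origin : ∀ {n} {ms : Vec ℕ (suc n)} → All (2 ≤_) ms → V (prodK ms)
origin {ms = _ ∷ []}    (ℕ.s≤s _ ∷ []) = zero
origin {ms = _ ∷ _ ∷ _} (ℕ.s≤s _ ∷ ps) = zero , origin ps

K-neighbour : ∀ {x} → 2 ≤ x → (a : Fin x) → ∃ λ b → Adj (K x) a b
K-neighbour (ℕ.s≤s (ℕ.s≤s _)) zero    = suc zero , λ ()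
K-neighbour (ℕ.s≤s (ℕ.s≤s _)) (suc _) = zero , λ ()

neighbour : ∀ {n} {ms : Vec ℕ (suc n)} → All (2 ≤_) ms → ∀ h → ∃ λ g → Adj (prodK ms) h g
neighbour {ms = _ ∷ []}    (2≤x ∷ [])   a       = K-neighbour 2≤x a
neighbour {ms = _ ∷ _ ∷ _} (2≤x ∷ ys≥2) (a , h) with K-neighbour 2≤x a | neighbour ys≥2 h
... | b , a~b | k , h~k = (b , k) , a~b , h~k

#common : ∀ {n} (ms : Vec ℕ (suc n)) → V (prodK ms) → V (prodK ms) → ℤ
#common ms = common (prodK ms) (vertices ms) (λ _ → 1ℤ)

#common-∷ : ∀ {n} x y (ys : Vec ℕ n) a h b k
  → #common (x ∷ y ∷ ys) (a , h) (b , k) ≡ (+ x - + 2 + δ (K x) a b) * #common (y ∷ ys) h k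
#common-∷ x y ys a h b k =
  trans (common-⊗ (K x) (prodK (y ∷ ys)) (allFin x) (vertices (y ∷ ys)) (λ _ → 1ℤ) (λ _ → 1ℤ) (λ _ → 1ℤ)
                  (λ _ _ → refl) a h b k)
        (cong (_* #common (y ∷ ys) h k) (common-K x a b))

module _ {Γ Λ : Graph} where

  twins-⊗ˡ : ∀ {b a a′} → TwinsOutside Γ b a a′ → ∀ {g} → ¬ Adj Λ g g → FarTwin (Γ ⊗ Λ) (a , g) (a′ , g)
  twins-⊗ˡ {b} twins g≁g = (b , _) , record
    { v≢u   = v≢u ∘ cong proj₁
    ; v′≢u  = v′≢u ∘ cong proj₁
    ; agree = λ (d , z) far → mk⇔
        (λ (a~d , g~z) → Equivalence.to (agree d (λ b~d → far (b~d , g~z))) a~d , g~z)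
        (λ (a′~d , g~z) → Equivalence.from (agree d (λ b~d → far (b~d , g~z))) a′~d , g~z)
    } , g≁g ∘ proj₂ , g≁g ∘ proj₂
    where open TwinsOutside twins

  twins-⊗ʳ : ∀ {k h h′} → TwinsOutside Λ k h h′ → ∀ {c} → ¬ Adj Γ c c → FarTwin (Γ ⊗ Λ) (c , h) (c , h′)
  twins-⊗ʳ {k} twins c≁c = (_ , k) , record
    { v≢u   = v≢u ∘ cong proj₂
    ; v′≢u  = v′≢u ∘ cong proj₂
    ; agree = λ (d , z) far → mk⇔
        (λ (c~d , h~z) → c~d , Equivalence.to (agree z (λ k~z → far (c~d , k~z))) h~z)
        (λ (c~d , h′~z) → c~d , Equivalence.from (agree z (λ k~z → far (c~d , k~z))) h′~z)
    } , c≁c ∘ proj₁ , c≁c ∘ proj₁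
    where open TwinsOutside twins

K-twins : ∀ {x} {b a a′ : Fin x} → a ≢ b → a′ ≢ b → TwinsOutside (K x) b a a′
K-twins {b = b} a≢b a′≢b = record
  { v≢u   = a≢b
  ; v′≢u  = a′≢b
  ; agree = λ d far → mk⇔ (λ _ a′≡d → a′≢b (trans a′≡d (equal d far))) (λ _ a≡d → a≢b (trans a≡d (equal d far)))
  }
  where
  equal : ∀ d → ¬ (b ≢ d) → d ≡ b
  equal d ¬b≢d = sym (decidable-stable (b ≟ᶠ d) ¬b≢d)

third-element : ∀ {x} → 3 ≤ x → (a a′ : Fin x) → ∃ λ b → a ≢ b × a′ ≢ b
third-element (ℕ.s≤s (ℕ.s≤s (ℕ.s≤s _))) zero          zero          = suc zero , (λ ()) , (λ ())
third-element (ℕ.s≤s (ℕ.s≤s (ℕ.s≤s _))) zero          (suc zero)    = suc (suc zero) , (λ ()) , (λ ())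
third-element (ℕ.s≤s (ℕ.s≤s (ℕ.s≤s _))) zero          (suc (suc _)) = suc zero , (λ ()) , (λ ())
third-element (ℕ.s≤s (ℕ.s≤s (ℕ.s≤s _))) (suc zero)    zero          = suc (suc zero) , (λ ()) , (λ ())
third-element (ℕ.s≤s (ℕ.s≤s (ℕ.s≤s _))) (suc zero)    (suc _)       = zero , (λ ()) , (λ ())
third-element (ℕ.s≤s (ℕ.s≤s (ℕ.s≤s _))) (suc (suc _)) zero          = suc zero , (λ ()) , (λ ())
third-element (ℕ.s≤s (ℕ.s≤s (ℕ.s≤s _))) (suc (suc _)) (suc _)       = zero , (λ ()) , (λ ())

K-twinned : ∀ {x} → 3 ≤ x → (a a′ : Fin x) → Twin (K x) a a′
K-twinned 3≤x a a′ with third-element 3≤x a a′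
... | b , a≢b , a′≢b = b , K-twins a≢b a′≢b

⊗-farTwinned : ∀ {x Λ} → 3 ≤ x → (∀ h h′ → Plus (Twin Λ) h h′) → (∀ h → ¬ Adj Λ h h)
  → ∀ v v′ → Plus (FarTwin (K x ⊗ Λ)) v v′
⊗-farTwinned {x} {Λ} 3≤x Λ-twinned Λ-irreflexive (a , h) (a′ , h′) =
  _ ∼⁺⟨ [ twins-⊗ˡ {K x} {Λ} (proj₂ (K-twinned 3≤x a a′)) (Λ-irreflexive h) ] ⟩
  Plus.map (λ (_ , twins) → twins-⊗ʳ {K x} {Λ} twins (λ a′≢a′ → a′≢a′ refl)) (Λ-twinned h h′)

prodK-twinned : ∀ {n} (ms : Vec ℕ (suc n)) → All (3 ≤_) ms → ∀ h h′ → Plus (Twin (prodK ms)) h h′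
prodK-twinned (x ∷ [])     (3≤x ∷ [])    a a′ = [ K-twinned 3≤x a a′ ]
prodK-twinned (x ∷ y ∷ ys) (3≤x ∷ ys≥3) v v′ =
  Plus.map farTwin⇒twin (⊗-farTwinned 3≤x (prodK-twinned (y ∷ ys) ys≥3) (prodK-irreflexive (y ∷ ys)) v v′)

module _ {I : ℤ → Set} (I-ideal : IsIdeal I) where
  open IsIdeal I-ideal
  open SetoidReasoning ≈-setoid

  #common≈δ : ∀ {n} (ms : Vec ℕ (suc n)) → All (λ m → I (+ m - + 2)) ms
    → ∀ u v → #common ms u v ≈ δ (prodK ms) u v
  #common≈δ (x ∷ []) (x-2∈ ∷ []) a b = begin
    #common (x ∷ []) a b        ≡⟨ common-K x a b ⟩
    + x - + 2 + δ (K x) a b     ≈⟨ +-congʳ (δ (K x) a b) (∈⇒≈0 x-2∈) ⟩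
    0ℤ + δ (K x) a b            ≡⟨ ℤ.+-identityˡ (δ (K x) a b) ⟩
    δ (K x) a b                 ∎
  #common≈δ (x ∷ y ∷ ys) (x-2∈ ∷ ys-2∈) (a , h) (b , k) = begin
    #common (x ∷ y ∷ ys) (a , h) (b , k)                    ≡⟨ #common-∷ x y ys a h b k ⟩
    (+ x - + 2 + δ (K x) a b) * #common (y ∷ ys) h k        ≈⟨ *-cong (+-congʳ (δ (K x) a b) (∈⇒≈0 x-2∈)) (#common≈δ (y ∷ ys) ys-2∈ h k) ⟩
    (0ℤ + δ (K x) a b) * δ (prodK (y ∷ ys)) h k             ≡⟨ cong (_* δ (prodK (y ∷ ys)) h k) (ℤ.+-identityˡ (δ (K x) a b)) ⟩
    δ (K x) a b * δ (prodK (y ∷ ys)) h k                    ≡⟨ δ-⊗ (K x) (prodK (y ∷ ys)) a h b k ⟨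
    δ (prodK (x ∷ y ∷ ys)) (a , h) (b , k)                  ∎

  module _ (c : ℤ) (c-unit : c * c ≡ 1ℤ) where

    -- With P = C(o, o), the hypotheses give (m − 2) P ≡ 0 and (m − 1) P ≡ c, hence P ≡ c and,
    -- c being a unit, m − 2 ≡ 0; then m − 1 ≡ 1 and the hypothesis descends to the tail.
    head-extract : ∀ {n} x y (ys : Vec ℕ n) (o : V (prodK (y ∷ ys)))
      → #common (suc (suc x) ∷ y ∷ ys) (suc zero , o) (zero , o) ≈ 0ℤ
      → (∀ h → #common (suc (suc x) ∷ y ∷ ys) (zero , h) (zero , o) ≈ c * δ (prodK (y ∷ ys)) o h)
      → I (+ suc (suc x) - + 2) × (∀ h → #common (y ∷ ys) h o ≈ c * δ (prodK (y ∷ ys)) o h)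
    head-extract x y ys o apart along = ≈0⇒∈ X≈0 , tail≈
      where
      X P : ℤ
      X = + suc (suc x) - + 2
      P = #common (y ∷ ys) o o
      XP≈0 : (X + 0ℤ) * P ≈ 0ℤ
      XP≈0 = ≈-trans (≈-reflexive (sym (#common-∷ (suc (suc x)) y ys (suc zero) o zero o))) apart
      P≈c : P ≈ c
      P≈c = begin
        P                                  ≡⟨ difference X P ⟩
        (X + 1ℤ) * P + -1ℤ * ((X + 0ℤ) * P) ≈⟨ +-cong (≈-trans (≈-reflexive (sym (#common-∷ (suc (suc x)) y ys zero o zero o))) (along o))
                                                (*-congˡ -1ℤ XP≈0) ⟩
        c * δ (prodK (y ∷ ys)) o o + -1ℤ * 0ℤ ≡⟨ cong (λ t → c * t + -1ℤ * 0ℤ) (δ-refl (prodK (y ∷ ys)) o) ⟩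
        c * 1ℤ + -1ℤ * 0ℤ                  ≡⟨ tidy c ⟩
        c                                  ∎
        where
        difference : ∀ X P → P ≡ (X + 1ℤ) * P + -1ℤ * ((X + 0ℤ) * P)
        difference = solve-∀
        tidy : ∀ c → c * 1ℤ + -1ℤ * 0ℤ ≡ c
        tidy = solve-∀
      X≈0 : X ≈ 0ℤ
      X≈0 = begin
        X                    ≡⟨ ℤ.*-identityʳ X ⟨
        X * 1ℤ               ≡⟨ cong (X *_) c-unit ⟨
        X * (c * c)          ≡⟨ regroup X c ⟩
        (X + 0ℤ) * c * c     ≈⟨ *-congʳ c (*-congˡ (X + 0ℤ) (≈-sym P≈c)) ⟩
        (X + 0ℤ) * P * c     ≈⟨ *-congʳ c XP≈0 ⟩
        0ℤ * c               ≡⟨ ℤ.*-zeroˡ c ⟩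
        0ℤ                   ∎
        where
        regroup : ∀ X c → X * (c * c) ≡ (X + 0ℤ) * c * c
        regroup = solve-∀
      tail≈ : ∀ h → #common (y ∷ ys) h o ≈ c * δ (prodK (y ∷ ys)) o h
      tail≈ h = begin
        #common (y ∷ ys) h o                  ≡⟨ ℤ.*-identityˡ _ ⟨
        1ℤ * #common (y ∷ ys) h o             ≈⟨ *-congʳ (#common (y ∷ ys) h o) (+-congʳ 1ℤ (≈-sym X≈0)) ⟩
        (X + 1ℤ) * #common (y ∷ ys) h o       ≡⟨ #common-∷ (suc (suc x)) y ys zero h zero o ⟨
        #common (suc (suc x) ∷ y ∷ ys) (zero , h) (zero , o) ≈⟨ along h ⟩
        c * δ (prodK (y ∷ ys)) o h            ∎

    all-extract : ∀ {n} {ms : Vec ℕ (suc n)} (ms≥2 : All (2 ≤_) ms)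
      → (∀ h → #common ms h (origin ms≥2) ≈ c * δ (prodK ms) (origin ms≥2) h)
      → All (λ m → I (+ m - + 2)) ms
    all-extract {ms = suc (suc x) ∷ []} (ℕ.s≤s (ℕ.s≤s _) ∷ []) along = ≈0⇒∈ X≈0 ∷ []
      where
      X≈0 : + suc (suc x) - + 2 ≈ 0ℤ
      X≈0 = begin
        + suc (suc x) - + 2                    ≡⟨ ℤ.+-identityʳ _ ⟨
        + suc (suc x) - + 2 + 0ℤ               ≡⟨ common-K (suc (suc x)) (suc zero) zero ⟨
        #common (suc (suc x) ∷ []) (suc zero) zero ≈⟨ along (suc zero) ⟩
        c * 0ℤ                                 ≡⟨ ℤ.*-zeroʳ c ⟩
        0ℤ                                     ∎
    all-extract {ms = suc (suc x) ∷ y ∷ ys} (ℕ.s≤s (ℕ.s≤s _) ∷ ys≥2) along =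
      proj₁ extracted ∷ all-extract ys≥2 (proj₂ extracted)
      where
      o : V (prodK (y ∷ ys))
      o = origin ys≥2
      Λ : Graph
      Λ = prodK (y ∷ ys)
      apart : #common (suc (suc x) ∷ y ∷ ys) (suc zero , o) (zero , o) ≈ 0ℤ
      apart = begin
        #common (suc (suc x) ∷ y ∷ ys) (suc zero , o) (zero , o) ≈⟨ along (suc zero , o) ⟩
        c * δ (prodK (suc (suc x) ∷ y ∷ ys)) (zero , o) (suc zero , o)
          ≡⟨ cong (c *_) (trans (δ-⊗ (K (suc (suc x))) Λ zero o (suc zero) o) (ℤ.*-zeroˡ (δ Λ o o))) ⟩
        c * 0ℤ                                                    ≡⟨ ℤ.*-zeroʳ c ⟩
        0ℤ                                                        ∎
      along-head : ∀ h → #common (suc (suc x) ∷ y ∷ ys) (zero , h) (zero , o) ≈ c * δ Λ o h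
      along-head h = begin
        #common (suc (suc x) ∷ y ∷ ys) (zero , h) (zero , o) ≈⟨ along (zero , h) ⟩
        c * δ (prodK (suc (suc x) ∷ y ∷ ys)) (zero , o) (zero , h)
          ≡⟨ cong (c *_) (trans (δ-⊗ (K (suc (suc x))) Λ zero o zero h) (ℤ.*-identityˡ (δ Λ o h))) ⟩
        c * δ Λ o h                                          ∎
      extracted : I (+ suc (suc x) - + 2) × (∀ h → #common (y ∷ ys) h o ≈ c * δ Λ o h)
      extracted = head-extract x y ys o apart along-head

module AllLarge {n} (x y : ℕ) (ys : Vec ℕ n) (ys≥3 : All (3 ≤_) (y ∷ ys)) where

  ms : Vec ℕ (suc (suc n))
  ms = 3 ℕ.+ x ∷ y ∷ ys

  Γ Λ : Graph
  Γ = prodK ms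
  Λ = prodK (y ∷ ys)

  ys≥2 : All (2 ≤_) (y ∷ ys)
  ys≥2 = ≥3⇒≥2 ys≥3

  o : V Λ
  o = origin ys≥2

  v₀ : V Γ
  v₀ = zero , o

  open Loopless Γ (prodK-irreflexive ms)

  linked : ∀ w → InRowSpan Γ (λ z → δ Γ w z - 1ℤ * δ Γ v₀ z)
  linked w = span-≗ Γ (λ z → cong (_-_ (δ Γ w z)) (sym (ℤ.*-identityˡ (δ Γ v₀ z))))
    (farTwinned-δ-difference (⊗-farTwinned (ℕ.s≤s (ℕ.s≤s (ℕ.s≤s ℕ.z≤n))) (prodK-twinned (y ∷ ys) ys≥3)
                                           (prodK-irreflexive (y ∷ ys)) w v₀))

  open SignCriterion Γ (vertices ms) (vertices-enumeration ms) (λ _ → 1ℤ) (λ _ → refl) v₀ linked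

  φ-meet-far : ∀ u → ¬ Adj Γ u v₀ → φ (row Γ (inj₂ (u , v₀))) ≡ δ Γ v₀ u + #common ms u v₀
  φ-meet-far u u≁v₀ = begin
    φ (row Γ (inj₂ (u , v₀)))                                   ≡⟨ φ-meet (vertices ms) (vertices-enumeration ms) (λ _ → 1ℤ) u v₀ ⟩
    1ℤ * N[ v₀ ] u + 1ℤ * α Γ u v₀ + #common ms u v₀           ≡⟨ cong₂ (λ p q → 1ℤ * p + 1ℤ * q + #common ms u v₀)
                                                                   (trans (N[]-split v₀ u) (cong (_+_ (δ Γ v₀ u)) (α-far v₀≁u)))
                                                                   (α-far u≁v₀) ⟩
    1ℤ * (δ Γ v₀ u + 0ℤ) + 1ℤ * 0ℤ + #common ms u v₀           ≡⟨ tidy (δ Γ v₀ u) (#common ms u v₀) ⟩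
    δ Γ v₀ u + #common ms u v₀                                 ∎
    where
    open ≡-Reasoning
    v₀≁u : ¬ Adj Γ v₀ u
    v₀≁u = u≁v₀ ∘ prodK-symmetric ms
    α-far : ∀ {a b} → ¬ Adj Γ a b → α Γ a b ≡ 0ℤ
    α-far {a} {b} = 𝟙-no (adj? Γ a b)
    tidy : ∀ d c → 1ℤ * (d + 0ℤ) + 1ℤ * 0ℤ + c ≡ d + c
    tidy = solve-∀

  ms≥2 : All (2 ≤_) ms
  ms≥2 = ℕ.s≤s (ℕ.s≤s ℕ.z≤n) ∷ ys≥2

  μ : ℕ
  μ = gcdVec (2 ∷ map (_∸ 2) ms)

  μ∈ : BaseIdeal (+ μ)
  μ∈ = gcdVec-closed (2 ∷ map (_∸ 2) ms) (2∈ ∷ excesses-closed {BaseIdeal} ms≥2 (proj₁ extracted ∷ tail-excesses∈))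
    where
    open IsIdeal baseIdeal
    open SetoidReasoning ≈-setoid
    far≈ : ∀ u → ¬ Adj Γ u v₀ → #common ms u v₀ ≈ -1ℤ * δ Γ v₀ u
    far≈ u u≁v₀ = by-difference (∈-resp (trans (φ-meet-far u u≁v₀) (shift (δ Γ v₀ u) (#common ms u v₀)))
                                        (φ∈BaseIdeal (span-row Γ (inj₂ (u , v₀)))))
      where
      shift : ∀ d c → d + c ≡ c - -1ℤ * d
      shift = solve-∀
    apart : #common ms (suc zero , o) v₀ ≈ 0ℤ
    apart = ≈-trans (far≈ (suc zero , o) (prodK-irreflexive (y ∷ ys) o ∘ proj₂))
                    (≈-reflexive (cong (-1ℤ *_) (trans (δ-⊗ (K (3 ℕ.+ x)) Λ zero o (suc zero) o) (ℤ.*-zeroˡ (δ Λ o o)))))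
    along : ∀ h → #common ms (zero , h) v₀ ≈ -1ℤ * δ Λ o h
    along h = ≈-trans (far≈ (zero , h) (λ (0≢0 , _) → 0≢0 refl))
                      (≈-reflexive (cong (-1ℤ *_) (trans (δ-⊗ (K (3 ℕ.+ x)) Λ zero o zero h) (ℤ.*-identityˡ (δ Λ o h)))))
    extracted : BaseIdeal (+ (3 ℕ.+ x) - + 2) × (∀ h → #common (y ∷ ys) h o ≈ -1ℤ * δ Λ o h)
    extracted = head-extract baseIdeal -1ℤ refl (suc x) y ys o apart along
    tail-excesses∈ : All (λ m → BaseIdeal (+ m - + 2)) (y ∷ ys)
    tail-excesses∈ = all-extract baseIdeal -1ℤ refl ys≥2 (proj₂ extracted)
    2∈ : BaseIdeal (+ 2)
    2∈ = difference∈ (begin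
      1ℤ                      ≡⟨ δ-refl Λ o ⟨
      δ Λ o o                 ≈⟨ #common≈δ baseIdeal (y ∷ ys) tail-excesses∈ o o ⟨
      #common (y ∷ ys) o o    ≈⟨ proj₂ extracted o ⟩
      -1ℤ * δ Λ o o           ≡⟨ cong (-1ℤ *_) (δ-refl Λ o) ⟩
      -1ℤ                     ∎)

  rows∣ : ∀ r → + μ ∣ℤ φ (row Γ r)
  rows∣ r = ≈0⇒∈ (row≈0 r)
    where
    open IsIdeal (∣-ideal (+ μ))
    open SetoidReasoning ≈-setoid
    2≈0 : + 2 ≈ 0ℤ
    2≈0 = ∈⇒≈0 (∣ᵤ⇒∣ (GCD.gcd[m,n]∣m 2 (gcdVec (map (_∸ 2) ms))))
    common≈δ : ∀ u v → #common ms u v ≈ δ Γ u v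
    common≈δ = #common≈δ (∣-ideal (+ μ)) ms
      (excesses-∣ ms≥2 (All.map (ℕD.∣-trans (GCD.gcd[m,n]∣n 2 (gcdVec (map (_∸ 2) ms)))) (gcdVec-∣ (map (_∸ 2) ms))))
    row≈0 : ∀ r → φ (row Γ r) ≈ 0ℤ
    row≈0 (inj₁ v) = begin
      φ (row Γ (inj₁ v))   ≡⟨ φ-N[] (vertices ms) (vertices-enumeration ms) (λ _ → 1ℤ) v ⟩
      1ℤ + #common ms v v  ≈⟨ +-congˡ 1ℤ (common≈δ v v) ⟩
      1ℤ + δ Γ v v         ≡⟨ cong (_+_ 1ℤ) (δ-refl Γ v) ⟩
      + 2                  ≈⟨ 2≈0 ⟩
      0ℤ                   ∎
    row≈0 (inj₂ (u , v)) = begin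
      φ (row Γ (inj₂ (u , v)))
        ≡⟨ φ-meet (vertices ms) (vertices-enumeration ms) (λ _ → 1ℤ) u v ⟩
      1ℤ * N[ v ] u + 1ℤ * α Γ u v + #common ms u v
        ≈⟨ +-congˡ (1ℤ * N[ v ] u + 1ℤ * α Γ u v) (common≈δ u v) ⟩
      1ℤ * N[ v ] u + 1ℤ * α Γ u v + δ Γ u v
        ≡⟨ cong₂ (λ p q → 1ℤ * p + 1ℤ * q + δ Γ u v) (N[]-split v u) (α-sym ms u v) ⟩
      1ℤ * (δ Γ v u + α Γ v u) + 1ℤ * α Γ v u + δ Γ u v
        ≡⟨ cong (_+_ (1ℤ * (δ Γ v u + α Γ v u) + 1ℤ * α Γ v u)) (δ-sym Γ u v) ⟩
      1ℤ * (δ Γ v u + α Γ v u) + 1ℤ * α Γ v u + δ Γ v u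
        ≡⟨ double (δ Γ v u) (α Γ v u) ⟩
      + 2 * (δ Γ v u + α Γ v u)
        ≈⟨ *-congʳ (δ Γ v u + α Γ v u) 2≈0 ⟩
      0ℤ * (δ Γ v u + α Γ v u)
        ≡⟨ ℤ.*-zeroˡ (δ Γ v u + α Γ v u) ⟩
      0ℤ ∎
      where
      double : ∀ d a → 1ℤ * (d + a) + 1ℤ * a + d ≡ + 2 * (d + a)
      double = solve-∀

  isRA : IsRA μ Γ
  isRA = isRA-bySign (ℕP.n≢0⇒n>0 (GCD.gcd[m,n]≢0 2 (gcdVec (map (_∸ 2) ms)) (inj₁ λ ()))) μ∈ rows∣

sign : Fin 2 → ℤ
sign zero       = 1ℤ
sign (suc zero) = -1ℤ

-- Modulo C ≡ δ, φ (N[a, h] ∩ N[b, k]) is the first expression times δ h k plus the second times α h k.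
K₂-balanced : ∀ a b → sign a * δ (K 2) b a + common (K 2) (allFin 2) sign a b ≡ 0ℤ
                    × sign a * α (K 2) b a + sign b * α (K 2) a b ≡ 0ℤ
K₂-balanced zero       zero       = refl , refl
K₂-balanced zero       (suc zero) = refl , refl
K₂-balanced (suc zero) zero       = refl , refl
K₂-balanced (suc zero) (suc zero) = refl , refl

module WithK₂ {n} (y : ℕ) (ys : Vec ℕ n) (ys≥3 : All (3 ≤_) (y ∷ ys)) where

  ms : Vec ℕ (suc (suc n))
  ms = 2 ∷ y ∷ ys

  Γ Λ : Graph
  Γ = prodK ms
  Λ = prodK (y ∷ ys)

  ys≥2 : All (2 ≤_) (y ∷ ys)
  ys≥2 = ≥3⇒≥2 ys≥3

  o : V Λ
  o = origin ys≥2

  v₀ : V Γ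
  v₀ = zero , o

  ε : V Γ → ℤ
  ε (a , _) = sign a

  ε-unit : ∀ v → ε v * ε v ≡ 1ℤ
  ε-unit (zero , _)     = refl
  ε-unit (suc zero , _) = refl

  σ : Fin 2 → Fin 2 → ℤ
  σ = common (K 2) (allFin 2) sign

  C : V Λ → V Λ → ℤ
  C = #common (y ∷ ys)

  open Loopless Γ (prodK-irreflexive ms)

  layer-linked : ∀ a h h′ → InRowSpan Γ (λ z → δ Γ (a , h) z - δ Γ (a , h′) z)
  layer-linked a h h′ = farTwinned-δ-difference
    (Plus.map (λ (_ , twins) → twins-⊗ʳ {K 2} {Λ} twins (λ a≢a → a≢a refl)) (prodK-twinned (y ∷ ys) ys≥3 h h′))

  -- Layer 1 is reached through an edge (1, k) ~ (0, g): in K₂ two adjacent vertices have no common neighbour.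
  linked : ∀ w → InRowSpan Γ (λ z → δ Γ w z - ε w * δ Γ v₀ z)
  linked (zero , h) = span-≗ Γ (λ z → cong (_-_ (δ Γ (zero , h) z)) (sym (ℤ.*-identityˡ (δ Γ v₀ z)))) (layer-linked zero h o)
  linked (suc zero , k) with neighbour ys≥2 k
  ... | g , k~g = span-≗ Γ (λ z → regroup (δ Γ (suc zero , k) z) (δ Γ (zero , g) z) (δ Γ v₀ z))
                    (span-difference Γ (adjacent-δ-sum ((λ ()) , k~g) ((λ ()) , prodK-symmetric (y ∷ ys) k~g) no-common)
                              (layer-linked zero g o))
    where
    no-common : ∀ w → ¬ (Adj Γ (suc zero , k) w × Adj Γ (zero , g) w)
    no-common (zero , _)     (_ , (0≢0 , _)) = 0≢0 refl
    no-common (suc zero , _) ((1≢1 , _) , _) = 1≢1 refl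
    regroup : ∀ p q r → p + q - (q - r) ≡ p - -1ℤ * r
    regroup = solve-∀

  open SignCriterion Γ (vertices ms) (vertices-enumeration ms) ε ε-unit v₀ linked

  common-Γ : ∀ a h b k → common Γ (vertices ms) ε (a , h) (b , k) ≡ σ a b * C h k
  common-Γ = common-⊗ (K 2) Λ (allFin 2) (vertices (y ∷ ys)) sign (λ _ → 1ℤ) ε (λ c _ → sym (ℤ.*-identityʳ (sign c)))

  φ-N-pair : ∀ a h → φ (row Γ (inj₁ (a , h))) ≡ sign a + σ a a * C h h
  φ-N-pair a h = trans (φ-N[] (vertices ms) (vertices-enumeration ms) ε (a , h)) (cong (_+_ (sign a)) (common-Γ a h a h))

  φ-meet-pair : ∀ a h b k → φ (row Γ (inj₂ ((a , h) , (b , k))))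
    ≡ sign a * (δ (K 2) b a * δ Λ k h + α (K 2) b a * α Λ k h) + sign b * (α (K 2) a b * α Λ h k) + σ a b * C h k
  φ-meet-pair a h b k = begin
    φ (row Γ (inj₂ ((a , h) , (b , k))))
      ≡⟨ φ-meet (vertices ms) (vertices-enumeration ms) ε (a , h) (b , k) ⟩
    sign a * N[ b , k ] (a , h) + sign b * α Γ (a , h) (b , k) + common Γ (vertices ms) ε (a , h) (b , k)
      ≡⟨ cong₂ (λ p q → sign a * p + sign b * q + common Γ (vertices ms) ε (a , h) (b , k))
               (trans (N[]-split (b , k) (a , h)) (cong₂ _+_ (δ-⊗ (K 2) Λ b k a h) (α-⊗ (K 2) Λ b k a h)))
               (α-⊗ (K 2) Λ a h b k) ⟩
    sign a * (δ (K 2) b a * δ Λ k h + α (K 2) b a * α Λ k h) + sign b * (α (K 2) a b * α Λ h k)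
      + common Γ (vertices ms) ε (a , h) (b , k)
      ≡⟨ cong (_+_ (sign a * (δ (K 2) b a * δ Λ k h + α (K 2) b a * α Λ k h) + sign b * (α (K 2) a b * α Λ h k)))
              (common-Γ a h b k) ⟩
    sign a * (δ (K 2) b a * δ Λ k h + α (K 2) b a * α Λ k h) + sign b * (α (K 2) a b * α Λ h k) + σ a b * C h k ∎
    where open ≡-Reasoning

  μ : ℕ
  μ = gcdVec (map (_∸ 2) (y ∷ ys))

  μ∈ : BaseIdeal (+ μ)
  μ∈ = gcdVec-closed (map (_∸ 2) (y ∷ ys)) (excesses-closed {BaseIdeal} ys≥2 (all-extract baseIdeal 1ℤ refl ys≥2 along))
    where
    open IsIdeal baseIdeal
    along : ∀ h → C h o ≈ 1ℤ * δ Λ o h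
    along h = by-difference (∈-resp (trans (cong (-1ℤ *_) (φ-meet-pair zero h zero o)) (flip (δ Λ o h) (α Λ o h) (α Λ h o) (C h o)))
                                    (*-closed -1ℤ {φ (row Γ (inj₂ ((zero , h) , v₀)))} (φ∈BaseIdeal (span-row Γ (inj₂ ((zero , h) , v₀))))))
      where
      flip : ∀ d a a′ c → -1ℤ * (1ℤ * (1ℤ * d + 0ℤ * a) + 1ℤ * (0ℤ * a′) + -1ℤ * c) ≡ c - 1ℤ * d
      flip = solve-∀

  rows∣ : ∀ r → + μ ∣ℤ φ (row Γ r)
  rows∣ r = ≈0⇒∈ (row≈0 r)
    where
    open IsIdeal (∣-ideal (+ μ))
    open SetoidReasoning ≈-setoid
    C≈δ : ∀ h k → C h k ≈ δ Λ h k
    C≈δ = #common≈δ (∣-ideal (+ μ)) (y ∷ ys) (excesses-∣ ys≥2 (gcdVec-∣ (map (_∸ 2) (y ∷ ys))))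
    row≈0 : ∀ r → φ (row Γ r) ≈ 0ℤ
    row≈0 (inj₁ (a , h)) = begin
      φ (row Γ (inj₁ (a , h)))              ≡⟨ φ-N-pair a h ⟩
      sign a + σ a a * C h h                ≈⟨ +-congˡ (sign a) (*-congˡ (σ a a) (C≈δ h h)) ⟩
      sign a + σ a a * δ Λ h h              ≡⟨ cong (λ q → sign a + σ a a * q) (δ-refl Λ h) ⟩
      sign a + σ a a * 1ℤ                   ≡⟨ tidy (sign a) (σ a a) ⟩
      sign a * 1ℤ + σ a a                   ≡⟨ cong (λ p → sign a * p + σ a a) (δ-refl (K 2) a) ⟨
      sign a * δ (K 2) a a + σ a a          ≡⟨ proj₁ (K₂-balanced a a) ⟩
      0ℤ                                    ∎
      where
      tidy : ∀ s c → s + c * 1ℤ ≡ s * 1ℤ + c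
      tidy = solve-∀
    row≈0 (inj₂ ((a , h) , (b , k))) = begin
      φ (row Γ (inj₂ ((a , h) , (b , k))))
        ≡⟨ φ-meet-pair a h b k ⟩
      sign a * (δ (K 2) b a * δ Λ k h + α (K 2) b a * α Λ k h) + sign b * (α (K 2) a b * α Λ h k) + σ a b * C h k
        ≈⟨ +-congˡ (sign a * (δ (K 2) b a * δ Λ k h + α (K 2) b a * α Λ k h) + sign b * (α (K 2) a b * α Λ h k))
                   (*-congˡ (σ a b) (C≈δ h k)) ⟩
      sign a * (δ (K 2) b a * δ Λ k h + α (K 2) b a * α Λ k h) + sign b * (α (K 2) a b * α Λ h k) + σ a b * δ Λ h k
        ≡⟨ cong₂ (λ p q → sign a * (δ (K 2) b a * p + α (K 2) b a * q) + sign b * (α (K 2) a b * α Λ h k) + σ a b * δ Λ h k)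
                 (δ-sym Λ k h) (α-sym (y ∷ ys) k h) ⟩
      sign a * (δ (K 2) b a * δ Λ h k + α (K 2) b a * α Λ h k) + sign b * (α (K 2) a b * α Λ h k) + σ a b * δ Λ h k
        ≡⟨ collect (sign a) (sign b) (δ (K 2) b a) (α (K 2) b a) (α (K 2) a b) (σ a b) (δ Λ h k) (α Λ h k) ⟩
      (sign a * δ (K 2) b a + σ a b) * δ Λ h k + (sign a * α (K 2) b a + sign b * α (K 2) a b) * α Λ h k
        ≡⟨ cong₂ (λ p q → p * δ Λ h k + q * α Λ h k) (proj₁ (K₂-balanced a b)) (proj₂ (K₂-balanced a b)) ⟩
      0ℤ * δ Λ h k + 0ℤ * α Λ h k
        ≡⟨ cong₂ _+_ (ℤ.*-zeroˡ (δ Λ h k)) (ℤ.*-zeroˡ (α Λ h k)) ⟩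
      0ℤ ∎
      where
      collect : ∀ s t d a a′ c e f → s * (d * e + a * f) + t * (a′ * f) + c * e ≡ (s * d + c) * e + (s * a + t * a′) * f
      collect = solve-∀

  isRA : IsRA μ Γ
  isRA = isRA-bySign (ℕP.n≢0⇒n>0 (GCD.gcd[m,n]≢0 (y ∸ 2) (gcdVec (map (_∸ 2) ys)) (inj₁ y-2≢0))) μ∈ rows∣
    where
    y-2≢0 : y ∸ 2 ≢ 0
    y-2≢0 y-2≡0 = ℕP.<⇒≱ (All.head ys≥3) (ℕP.m∸n≡0⇒m≤n y-2≡0)

withK₂-isRA : ∀ {n} y (ys : Vec ℕ n) → All (3 ≤_) (y ∷ ys)
  → IsRA (gcdVec (map (_∸ 2) (y ∷ ys))) (prodK (2 ∷ y ∷ ys))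
withK₂-isRA = WithK₂.isRA

allLarge-isRA : ∀ {n} x y (ys : Vec ℕ n) → 3 ≤ x → All (3 ≤_) (y ∷ ys)
  → IsRA (gcdVec (2 ∷ map (_∸ 2) (x ∷ y ∷ ys))) (prodK (x ∷ y ∷ ys))
allLarge-isRA (suc (suc (suc x))) y ys (ℕ.s≤s (ℕ.s≤s (ℕ.s≤s ℕ.z≤n))) = AllLarge.isRA x y ys

tail≥3 : ∀ {n x y} {ys : Vec ℕ n} → (∀ i j → i ≤ᶠ j → lookup (x ∷ y ∷ ys) i ≤ lookup (x ∷ y ∷ ys) j)
  → 3 ≤ y → All (3 ≤_) (y ∷ ys)
tail≥3 sorted 3≤y = All⁺.lookup⁻ (λ i → ℕP.≤-trans 3≤y (sorted (suc zero) (suc i) (ℕ.s≤s ℕ.z≤n)))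

mainTheorem13 : (n : ℕ) (m : Vec ℕ (suc (suc n)))
    → (∀ i j → i ≤ᶠ j → lookup m i ≤ lookup m j)
    → 2 ≤ lookup m zero
    → 3 ≤ lookup m (suc zero)
    → ∃ λ μ → IsRA μ (prodK m)
        × (lookup m zero ≡ 2 → μ ≡ gcdVec (map (λ x → x ∸ 2) (tail m)))
        × (lookup m zero ≢ 2 → μ ≤ 2 × (μ ≡ 2 ⇔ (∀ i → 2 ∣ lookup m i)))
mainTheorem13 n (x ∷ y ∷ ys) sorted 2≤x 3≤y with x ℕP.≟ 2
... | yes refl = _ , withK₂-isRA y ys (tail≥3 sorted 3≤y) , (λ _ → refl) , λ 2≢2 → contradiction refl 2≢2
... | no x≢2   = _ , allLarge-isRA x y ys (ℕP.≤∧≢⇒< 2≤x (x≢2 ∘ sym)) (tail≥3 sorted 3≤y)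
                   , (λ x≡2 → contradiction x≡2 x≢2)
                   , λ _ → proj₁ bounds , mk⇔ (All⁺.lookup⁺ ∘ Equivalence.to (proj₂ bounds))
                                              (Equivalence.from (proj₂ bounds) ∘ All⁺.lookup⁻)
  where
  bounds : gcdVec (2 ∷ map (_∸ 2) (x ∷ y ∷ ys)) ≤ 2
         × (gcdVec (2 ∷ map (_∸ 2) (x ∷ y ∷ ys)) ≡ 2 ⇔ All (2 ∣_) (x ∷ y ∷ ys))
  bounds = gcd-two-excesses (2≤x ∷ ≥3⇒≥2 (tail≥3 sorted 3≤y))
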